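{- Let $m,n\ge 0$ be integers and let $\Sigma=(+K_m)\vee_{+}(-K_n)$. Then \[ \mathsf E(\Sigma,x)=H_1(0,m,n,x),\qquad \mathsf O(\Sigma,x)=\mathsf E(\Sigma,x-1)+m\,H_1(0,m-1,n,x-1)+n\,H_1(0,m,n-1,x-1). \]
   Context: A signed graph $\Sigma=(\Gamma,\sigma)$ is a finite simple graph $\Gamma$ with a signature $\sigma:E(\Gamma)\to\{\pm1\}$. $+K_n$ (resp. $-K_n$) is the complete graph on $n$ vertices with all edges positive (resp. negative); $K_0$ is the empty signed graph. For signed graphs $\Sigma_1,\Sigma_2$ on disjoint vertex sets, the all-positive join $\Sigma_1\vee_{+}\Sigma_2$ is obtained from their disjoint union by joining every vertex of $\Sigma_1$ to every vertex of $\Sigma_2$ by a positive edge. For an integer $\lambda\ge 0$, let $C_\lambda$ be the set of nonzero integers in $[-\lambda/2,\lambda/2]$ if $\lambda$ is even, and the set of integers in $[-(\lambda-1)/2,(\lambda-1)/2]$ if $\lambda$ is odd. A proper $C_\lambda$-colouring of $\Sigma$ is a map $\kappa:V(\Gamma)\to C_\lambda$ with $\kappa(v)\ne\sigma(\{v,w\})\kappa(w)$ for every edge $\{v,w\}$; $f(\Sigma,\lambda)$ denotes their number. $\mathsf E(\Sigma,x),\mathsf O(\Sigma,x)\in\mathbb Z[x]$ are the unique polynomials with $f(\Sigma,\lambda)=\mathsf E(\Sigma,\lambda)$ for all even $\lambda\ge0$ and $f(\Sigma,\lambda)=\mathsf O(\Sigma,\lambda)$ for all odd $\lambda\ge0$.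 Notation: $(x)_n=\prod_{j=0}^{n-1}(x-j)$, ${}_2(x)_n=\prod_{j=0}^{n-1}(x-2j)$ (both $1$ for $n=0$); $S(n,k)$ is the Stirling number of the second kind ($S(0,0)=1$). For integers $l,m,n\ge0$, \[ H_1(l,m,n,x)=\sum_{i=0}^{l}\sum_{j=0}^{n}\sum_{k=0}^{\min(i,j)} k!\binom{i}{k}\binom{j}{k}S(l,i)S(n,j)\,{}_2(x)_{i+j-k}\,(x-i-j)_m, \] and $H_1(l,m,n,x)=0$ if any of $l,m,n$ is negative. (In particular $H_1(0,m,n,x)=\sum_{j=0}^n S(n,j)\,{}_2(x)_j\,(x-j)_m$ for $m,n\ge0$.) -}

module Defs where

open import Data.Bool using (Bool; true; false; not; _∧_)
open import Data.Nat as ℕ using (ℕ; zero; suc)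
open import Data.Integer as ℤ using (ℤ; +_; -[1+_]; +[1+_])
open import Data.Fin as Fin using (Fin; splitAt)
open import Data.Sum using (_⊎_; inj₁; inj₂)
open import Data.Maybe using (Maybe; just; nothing)
open import Data.List using (List; []; _∷_; _++_; map; concatMap; upTo; allFin; filterᵇ; length)
open import Data.Vec using (Vec; lookup) renaming ([] to []ᵥ; _∷_ to _∷ᵥ_)
open import Relation.Nullary using (yes; no; ¬_)
open import Relation.Nullary.Decidable using (⌊_⌋)
open import Relation.Binary.PropositionalEquality using (_≡_; refl; sym)
open import Data.Empty using (⊥-elim)

data Sign : Set where
  pos neg : Sign

_·_ : Sign → ℤ → ℤ
pos · a = a
neg · a = ℤ.- a

-- A finite simple signed graph on vertex set Fin order:
-- edge v w = nothing if {v,w} is not an edge, just s if it is an edge of sign s.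
record SignedGraph : Set where
  field
    order  : ℕ
    edge   : Fin order → Fin order → Maybe Sign
    symm   : ∀ v w → edge v w ≡ edge w v
    noLoop : ∀ v → edge v v ≡ nothing
open SignedGraph public

completeEdge : ∀ {n} → Sign → Fin n → Fin n → Maybe Sign
completeEdge s i j with i Fin.≟ j
... | yes _ = nothing
... | no  _ = just s

completeSymm : ∀ {n} (s : Sign) (i j : Fin n) → completeEdge s i j ≡ completeEdge s j i
completeSymm s i j with i Fin.≟ j | j Fin.≟ i
... | yes _ | yes _ = refl
... | no  _ | no  _ = refl
... | yes p | no ¬q = ⊥-elim (¬q (sym p))
... | no ¬p | yes q = ⊥-elim (¬p (sym q))

completeNoLoop : ∀ {n} (s : Sign) (i : Fin n) → completeEdge s i i ≡ nothing
completeNoLoop s i with i Fin.≟ i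
... | yes _ = refl
... | no ¬p = ⊥-elim (¬p refl)

K : Sign → ℕ → SignedGraph
K s n = record { order = n ; edge = completeEdge s ; symm = completeSymm s ; noLoop = completeNoLoop s }

+K -K : ℕ → SignedGraph
+K = K pos
-K = K neg

-- all-positive join: vertices of Σ₁ are Fin (order Σ₁) embedded on the left,
-- vertices of Σ₂ on the right of Fin (order Σ₁ + order Σ₂)
joinEdge : (Σ₁ Σ₂ : SignedGraph) → Fin (order Σ₁ ℕ.+ order Σ₂) → Fin (order Σ₁ ℕ.+ order Σ₂) → Maybe Sign
joinEdge Σ₁ Σ₂ v w with splitAt (order Σ₁) v | splitAt (order Σ₁) w
... | inj₁ a | inj₁ b = edge Σ₁ a b
... | inj₂ a | inj₂ b = edge Σ₂ a b
... | inj₁ _ | inj₂ _ = just pos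
... | inj₂ _ | inj₁ _ = just pos

joinSymm : (Σ₁ Σ₂ : SignedGraph) → ∀ v w → joinEdge Σ₁ Σ₂ v w ≡ joinEdge Σ₁ Σ₂ w v
joinSymm Σ₁ Σ₂ v w with splitAt (order Σ₁) v | splitAt (order Σ₁) w
... | inj₁ a | inj₁ b = symm Σ₁ a b
... | inj₂ a | inj₂ b = symm Σ₂ a b
... | inj₁ _ | inj₂ _ = refl
... | inj₂ _ | inj₁ _ = refl

joinNoLoop : (Σ₁ Σ₂ : SignedGraph) → ∀ v → joinEdge Σ₁ Σ₂ v v ≡ nothing
joinNoLoop Σ₁ Σ₂ v with splitAt (order Σ₁) v
... | inj₁ a = noLoop Σ₁ a
... | inj₂ a = noLoop Σ₂ a

_∨₊_ : SignedGraph → SignedGraph → SignedGraph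
Σ₁ ∨₊ Σ₂ = record
  { order = order Σ₁ ℕ.+ order Σ₂
  ; edge = joinEdge Σ₁ Σ₂
  ; symm = joinSymm Σ₁ Σ₂
  ; noLoop = joinNoLoop Σ₁ Σ₂ }

-- C_λ, listed without repetition:
-- λ even: ±1, …, ±λ/2 ;  λ odd: 0, ±1, …, ±(λ-1)/2
C : ℕ → List ℤ
C q = zeroPart ++ concatMap (λ k → +[1+ k ] ∷ -[1+ k ] ∷ []) (upTo (q ℕ./ 2))
  where
  zeroPart : List ℤ
  zeroPart with q ℕ.% 2
  ... | zero  = []
  ... | suc _ = + 0 ∷ []

allVecs : ∀ {A : Set} (N : ℕ) → List A → List (Vec A N)
allVecs zero    xs = []ᵥ ∷ []
allVecs (suc N) xs = concatMap (λ x → map (x ∷ᵥ_) (allVecs N xs)) xs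

allᵇ : ∀ {A : Set} → (A → Bool) → List A → Bool
allᵇ p []       = true
allᵇ p (x ∷ xs) = p x ∧ allᵇ p xs

properᵇ : (Σ : SignedGraph) → Vec ℤ (order Σ) → Bool
properᵇ Σ κ = allᵇ (λ v → allᵇ (λ w → ok v w (edge Σ v w)) (allFin _)) (allFin _)
  where
  ok : Fin (order Σ) → Fin (order Σ) → Maybe Sign → Bool
  ok v w nothing  = true
  ok v w (just s) = not ⌊ lookup κ v ℤ.≟ (s · lookup κ w) ⌋

chrom : SignedGraph → ℕ → ℕ
chrom Σ q = length (filterᵇ (properᵇ Σ) (allVecs (order Σ) (C q)))

sumTo : ℕ → (ℕ → ℤ) → ℤ
sumTo zero    g = g 0
sumTo (suc n) g = sumTo n g ℤ.+ g (suc n)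

falling : ℤ → ℕ → ℤ
falling x zero    = + 1
falling x (suc n) = falling x n ℤ.* (x ℤ.- + n)

falling₂ : ℤ → ℕ → ℤ
falling₂ x zero    = + 1
falling₂ x (suc n) = falling₂ x n ℤ.* (x ℤ.- + (2 ℕ.* n))

stirling : ℕ → ℕ → ℕ
stirling zero    zero    = 1
stirling zero    (suc k) = 0
stirling (suc n) zero    = 0
stirling (suc n) (suc k) = suc k ℕ.* stirling n (suc k) ℕ.+ stirling n k

factorial : ℕ → ℕ
factorial zero    = 1
factorial (suc n) = suc n ℕ.* factorial n

binom : ℕ → ℕ → ℕ
binom n       zero    = 1
binom zero    (suc k) = 0
binom (suc n) (suc k) = binom n k ℕ.+ binom n (suc k)

H₁ℕ : ℕ → ℕ → ℕ → ℤ → ℤ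
H₁ℕ l m n x =
  sumTo l λ i → sumTo n λ j → sumTo (ℕ._⊓_ i j) λ k →
    + (factorial k ℕ.* binom i k ℕ.* binom j k ℕ.* stirling l i ℕ.* stirling n j)
    ℤ.* falling₂ x ((i ℕ.+ j) ℕ.∸ k)
    ℤ.* falling (x ℤ.- + (i ℕ.+ j)) m

-- H₁ with integer l, m, n : zero if any of them is negative
H₁ : ℤ → ℤ → ℤ → ℤ → ℤ
H₁ (+ l) (+ m) (+ n) x = H₁ℕ l m n x
H₁ _     _     _     x = + 0

{-# OPTIONS --safe #-}
-- Colour the vertices one at a time: a vertex of +K m must avoid all colours used so far, a vertex
-- of -K n must avoid the colours of +K m and the negatives of the colours of -K n.  This sequential
-- count does not depend on the order of the vertices, so -K n may be coloured first.  With the 2k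
-- colours ±1, …, ±k, the vertices of -K n sharing a colour form a partition into j blocks whose
-- colours come from j distinct pairs ±c (2k(2k-2)⋯ choices), and then +K m takes m distinct colours
-- among the 2k - j left: this is H₁(0, m, n, 2k).  The extra colour 0 of C(2k+1) can be used by at
-- most one vertex, and deleting that vertex gives the two correction terms of O.
module Submission where

module Sums where
  open import Data.Bool using (Bool; true; false; _∨_; if_then_else_)
  open import Data.Nat using (ℕ; suc; _+_; _*_; _<_; _≟_)
  open import Data.Nat.Properties
    using (+-commutativeSemigroup; +-assoc; +-suc; *-zeroʳ; *-identityˡ; *-distribˡ-+; *-distribʳ-+;
           ≤-refl; ≤-pred; ≤∧≢⇒<; <⇒≢; m<n⇒m<1+n)
  open import Algebra.Properties.CommutativeSemigroup +-commutativeSemigroup using (x∙yz≈y∙xz)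
  open import Data.List using (List; []; _∷_; _++_; map; concatMap; filterᵇ; length; downFrom)
  open import Data.List.Membership.Propositional using (_∈_)
  open import Data.List.Relation.Unary.Any using (here; there)
  open import Data.List.Relation.Binary.Permutation.Propositional as ↭ using (_↭_)
  open import Function using (_∘_)
  open import Relation.Nullary using (yes; no)
  open import Relation.Binary.PropositionalEquality
    using (_≡_; _≢_; refl; sym; trans; cong; cong₂; module ≡-Reasoning)
  open ≡-Reasoning

  private variable
    X Y : Set

  sumOver : (X → ℕ) → List X → ℕ
  sumOver f []       = 0
  sumOver f (x ∷ xs) = f x + sumOver f xs

  sumOver-cong : ∀ {f g : X → ℕ} xs → (∀ {x} → x ∈ xs → f x ≡ g x) → sumOver f xs ≡ sumOver g xs
  sumOver-cong []       f≗g = refl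
  sumOver-cong (x ∷ xs) f≗g = cong₂ _+_ (f≗g (here refl)) (sumOver-cong xs (f≗g ∘ there))

  sumOver-0 : (xs : List X) → sumOver (λ _ → 0) xs ≡ 0
  sumOver-0 []       = refl
  sumOver-0 (x ∷ xs) = sumOver-0 xs

  sumOver-+ : ∀ (f g : X → ℕ) xs → sumOver (λ x → f x + g x) xs ≡ sumOver f xs + sumOver g xs
  sumOver-+ f g []       = refl
  sumOver-+ f g (x ∷ xs) = begin
    f x + g x + sumOver (λ x → f x + g x) xs ≡⟨ cong (f x + g x +_) (sumOver-+ f g xs) ⟩
    f x + g x + (sumOver f xs + sumOver g xs) ≡⟨ +-assoc (f x) (g x) _ ⟩
    f x + (g x + (sumOver f xs + sumOver g xs)) ≡⟨ cong (f x +_) (x∙yz≈y∙xz (g x) (sumOver f xs) _) ⟩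
    f x + (sumOver f xs + (g x + sumOver g xs)) ≡⟨ sym (+-assoc (f x) (sumOver f xs) _) ⟩
    f x + sumOver f xs + (g x + sumOver g xs) ∎

  sumOver-*ˡ : ∀ c (f : X → ℕ) xs → sumOver (λ x → c * f x) xs ≡ c * sumOver f xs
  sumOver-*ˡ c f []       = sym (*-zeroʳ c)
  sumOver-*ˡ c f (x ∷ xs) = trans (cong (c * f x +_) (sumOver-*ˡ c f xs)) (sym (*-distribˡ-+ c (f x) _))

  sumOver-*ʳ : ∀ c (f : X → ℕ) xs → sumOver (λ x → f x * c) xs ≡ sumOver f xs * c
  sumOver-*ʳ c f []       = refl
  sumOver-*ʳ c f (x ∷ xs) = trans (cong (f x * c +_) (sumOver-*ʳ c f xs)) (sym (*-distribʳ-+ c (f x) _))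

  sumOver-swap : ∀ (g : X → Y → ℕ) xs ys →
    sumOver (λ x → sumOver (g x) ys) xs ≡ sumOver (λ y → sumOver (λ x → g x y) xs) ys
  sumOver-swap g []       ys = sym (sumOver-0 ys)
  sumOver-swap g (x ∷ xs) ys = trans (cong (sumOver (g x) ys +_) (sumOver-swap g xs ys))
                                     (sym (sumOver-+ (g x) (λ y → sumOver (λ x → g x y) xs) ys))

  sumOver-map : ∀ (f : Y → ℕ) (h : X → Y) xs → sumOver f (map h xs) ≡ sumOver (f ∘ h) xs
  sumOver-map f h []       = refl
  sumOver-map f h (x ∷ xs) = cong (f (h x) +_) (sumOver-map f h xs)

  sumOver-++ : ∀ (f : X → ℕ) xs ys → sumOver f (xs ++ ys) ≡ sumOver f xs + sumOver f ys
  sumOver-++ f []       ys = refl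
  sumOver-++ f (x ∷ xs) ys = trans (cong (f x +_) (sumOver-++ f xs ys)) (sym (+-assoc (f x) _ _))

  sumOver-concatMap : ∀ (f : Y → ℕ) (h : X → List Y) xs →
    sumOver f (concatMap h xs) ≡ sumOver (sumOver f ∘ h) xs
  sumOver-concatMap f h []       = refl
  sumOver-concatMap f h (x ∷ xs) =
    trans (sumOver-++ f (h x) (concatMap h xs)) (cong (sumOver f (h x) +_) (sumOver-concatMap f h xs))

  sumOver-↭ : ∀ (f : X → ℕ) {xs ys} → xs ↭ ys → sumOver f xs ≡ sumOver f ys
  sumOver-↭ f ↭.refl           = refl
  sumOver-↭ f (↭.prep x p)     = cong (f x +_) (sumOver-↭ f p)
  sumOver-↭ f (↭.swap x y p)   =
    trans (x∙yz≈y∙xz (f x) (f y) _) (cong (λ s → f y + (f x + s)) (sumOver-↭ f p))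
  sumOver-↭ f (↭.trans p q)    = trans (sumOver-↭ f p) (sumOver-↭ f q)

  length-filterᵇ : ∀ (p : X → Bool) xs → length (filterᵇ p xs) ≡ sumOver (λ x → if p x then 1 else 0) xs
  length-filterᵇ p []       = refl
  length-filterᵇ p (x ∷ xs) with p x
  ... | true  = cong suc (length-filterᵇ p xs)
  ... | false = length-filterᵇ p xs

  sumOver-if : ∀ b (f : X → ℕ) xs → (if b then 0 else sumOver f xs) ≡ sumOver (λ x → if b then 0 else f x) xs
  sumOver-if true  f xs = sym (sumOver-0 xs)
  sumOver-if false f xs = refl

  sumOver-if-const : ∀ (p : X → Bool) c xs →
    sumOver (λ x → if p x then 0 else c) xs ≡ sumOver (λ x → if p x then 0 else 1) xs * c
  sumOver-if-const p c xs =
    trans (sumOver-cong xs (λ {x} _ → ifc (p x))) (sumOver-*ʳ c (λ x → if p x then 0 else 1) xs)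
    where
    ifc : ∀ b → (if b then 0 else c) ≡ (if b then 0 else 1) * c
    ifc true  = refl
    ifc false = sym (*-identityˡ c)

  sumOver-if-split : ∀ (p : X → Bool) a b xs →
    sumOver (λ x → if p x then a else b) xs
      ≡ sumOver (λ x → if p x then 1 else 0) xs * a + sumOver (λ x → if p x then 0 else 1) xs * b
  sumOver-if-split p a b []       = refl
  sumOver-if-split p a b (x ∷ xs) with p x
  ... | true  = trans (cong (a +_) (sumOver-if-split p a b xs)) (sym (+-assoc a _ _))
  ... | false = trans (cong (b +_) (sumOver-if-split p a b xs))
                      (x∙yz≈y∙xz b (sumOver (λ x → if p x then 1 else 0) xs * a) _)

  if-+ : ∀ b {m n : ℕ} → (if b then 0 else m + n) ≡ (if b then 0 else m) + (if b then 0 else n)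
  if-+ true  = refl
  if-+ false = refl

  if-guards-swap : ∀ a b q {c : ℕ} →
    (if a then 0 else if q ∨ b then 0 else c) ≡ (if b then 0 else if q ∨ a then 0 else c)
  if-guards-swap true  true  _     = refl
  if-guards-swap true  false true  = refl
  if-guards-swap true  false false = refl
  if-guards-swap false true  true  = refl
  if-guards-swap false true  false = refl
  if-guards-swap false false _     = refl

  ∈-downFrom⁻ : ∀ {i K} → i ∈ downFrom K → i < K
  ∈-downFrom⁻ {K = suc K} (here refl) = ≤-refl
  ∈-downFrom⁻ {K = suc K} (there p)   = m<n⇒m<1+n (∈-downFrom⁻ p)

  sumOver-downFrom-bump : ∀ {K j} {g h : ℕ → ℕ} → j < K → (∀ {i} → i ≢ j → g i ≡ h i) →
    g j ≡ 0 → h j ≡ 1 → sumOver h (downFrom K) ≡ suc (sumOver g (downFrom K))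
  sumOver-downFrom-bump {suc K} {j} {g} {h} j<1+K g≗h gj≡0 hj≡1 with j ≟ K
  ... | yes refl = begin
    h j + sumOver h (downFrom j) ≡⟨ cong₂ _+_ hj≡1 (sym (sumOver-cong (downFrom j) below)) ⟩
    suc (sumOver g (downFrom j)) ≡⟨ cong (λ z → suc (z + sumOver g (downFrom j))) (sym gj≡0) ⟩
    suc (g j + sumOver g (downFrom j)) ∎
    where
    below : ∀ {i} → i ∈ downFrom j → g i ≡ h i
    below i∈ = g≗h (<⇒≢ (∈-downFrom⁻ i∈))
  ... | no j≢K = begin
    h K + sumOver h (downFrom K) ≡⟨ cong₂ _+_ (sym (g≗h (j≢K ∘ sym)))
                                      (sumOver-downFrom-bump (≤∧≢⇒< (≤-pred j<1+K) j≢K) g≗h gj≡0 hj≡1) ⟩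
    g K + suc (sumOver g (downFrom K)) ≡⟨ +-suc (g K) _ ⟩
    suc (g K + sumOver g (downFrom K)) ∎

module Membership where
  open import Data.Bool using (Bool; true; false; _∨_)
  open import Data.Bool.Properties using (∨-assoc; ∨-comm; ∨-zeroʳ)
  open import Data.Integer using (ℤ; -_; _≟_)
  open import Data.Integer.Properties using (neg-involutive)
  open import Data.List using (List; []; _∷_; map)
  open import Data.List.Membership.Propositional using (_∈_; _∉_)
  open import Function using (case_of_)
  open import Relation.Nullary using (yes; no)
  open import Relation.Nullary.Decidable using (⌊_⌋)
  open import Relation.Nullary.Negation using (contradiction)
  open import Relation.Binary.PropositionalEquality using (_≡_; _≢_; refl; sym; trans; cong; cong₂; subst)

  infix 4 _==_ _∈ᵇ_

  _==_ : ℤ → ℤ → Bool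
  x == y = ⌊ x ≟ y ⌋

  _∈ᵇ_ : ℤ → List ℤ → Bool
  x ∈ᵇ []       = false
  x ∈ᵇ (y ∷ ys) = (x == y) ∨ (x ∈ᵇ ys)

  ==-refl : ∀ x → (x == x) ≡ true
  ==-refl x with x ≟ x
  ... | yes _   = refl
  ... | no  x≢x = contradiction refl x≢x

  ==-≢ : ∀ {x y} → x ≢ y → (x == y) ≡ false
  ==-≢ {x} {y} x≢y with x ≟ y
  ... | yes x≡y = contradiction x≡y x≢y
  ... | no  _   = refl

  ==-sound : ∀ {x y} → (x == y) ≡ true → x ≡ y
  ==-sound {x} {y} eq with x ≟ y
  ... | yes x≡y = x≡y

  ==-false⇒≢ : ∀ {x y} → (x == y) ≡ false → x ≢ y
  ==-false⇒≢ {x} x≠y refl = case trans (sym (==-refl x)) x≠y of λ ()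

  ==-⇔ : ∀ {x y u v} → (x ≡ y → u ≡ v) → (u ≡ v → x ≡ y) → (x == y) ≡ (u == v)
  ==-⇔ {x} {y} {u} {v} to from with x ≟ y | u ≟ v
  ... | yes _   | yes _   = refl
  ... | no  _   | no  _   = refl
  ... | yes x≡y | no  u≢v = contradiction (to x≡y) u≢v
  ... | no  x≢y | yes u≡v = contradiction (from u≡v) x≢y

  ∈ᵇ-map-neg : ∀ y F → (y ∈ᵇ map -_ F) ≡ (- y ∈ᵇ F)
  ∈ᵇ-map-neg y []       = refl
  ∈ᵇ-map-neg y (z ∷ F)  = cong₂ _∨_
    (==-⇔ (λ y≡-z → trans (cong -_ y≡-z) (neg-involutive z))
          (λ -y≡z → trans (sym (neg-involutive y)) (cong -_ -y≡z)))
    (∈ᵇ-map-neg y F)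

  ∈ᵇ-there : ∀ {y} x F → (y ∈ᵇ F) ≡ true → (y ∈ᵇ (x ∷ F)) ≡ true
  ∈ᵇ-there {y} x F y∈F = trans (cong ((y == x) ∨_) y∈F) (∨-zeroʳ (y == x))

  ∈ᵇ-∷-false : ∀ {y x} F → y ≢ x → (y ∈ᵇ F) ≡ false → (y ∈ᵇ (x ∷ F)) ≡ false
  ∈ᵇ-∷-false F y≢x y∉F rewrite ==-≢ y≢x = y∉F

  ∈ᵇ-here : ∀ x F → (x ∈ᵇ (x ∷ F)) ≡ true
  ∈ᵇ-here x F = cong (_∨ (x ∈ᵇ F)) (==-refl x)

  record AgreeOn (L F G : List ℤ) : Set where
    constructor agreeOn
    field ∈ᵇ-agree : ∀ {y} → y ∈ L → (y ∈ᵇ F) ≡ (y ∈ᵇ G)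
  open AgreeOn public

  agree-∷ : ∀ {L F G} x → AgreeOn L F G → AgreeOn L (x ∷ F) (x ∷ G)
  agree-∷ x F≈G = agreeOn λ y∈L → cong (_ ∨_) (∈ᵇ-agree F≈G y∈L)

  agree-swap : ∀ {L} x z F → AgreeOn L (x ∷ z ∷ F) (z ∷ x ∷ F)
  agree-swap x z F = agreeOn λ {y} _ → trans (sym (∨-assoc (y == x) _ _))
    (trans (cong (_∨ (y ∈ᵇ F)) (∨-comm (y == x) (y == z))) (∨-assoc (y == z) _ _))

  agree-dup : ∀ {L x} F → (x ∈ᵇ F) ≡ true → AgreeOn L (x ∷ F) F
  agree-dup {L} {x} F x∈F = agreeOn dup
    where
    dup : ∀ {y} → y ∈ L → (y ∈ᵇ (x ∷ F)) ≡ (y ∈ᵇ F)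
    dup {y} _ with y == x in y==x
    ... | true  = sym (subst (λ z → (z ∈ᵇ F) ≡ true) (sym (==-sound y==x)) x∈F)
    ... | false = refl

  agree-absent : ∀ {L x} F → x ∉ L → AgreeOn L (x ∷ F) F
  agree-absent {x = x} F x∉L = agreeOn λ {y} y∈L →
    cong (_∨ (y ∈ᵇ F)) (==-≢ (λ y≡x → x∉L (subst (_∈ _) y≡x y∈L)))

module Counting where
  open import Defs using (Sign; pos; neg; _·_)
  open import Data.Bool using (Bool; true; false; _∨_; if_then_else_)
  open import Data.Nat using (ℕ; zero; suc; pred; _+_; _*_)
  open import Data.Nat.Properties using (+-commutativeSemigroup; +-assoc; +-suc)
  open import Algebra.Properties.CommutativeSemigroup +-commutativeSemigroup using (x∙yz≈y∙xz)
  open import Data.Integer using (ℤ; +0; -_)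
  open import Data.Integer.Properties using (neg-involutive)
  open import Data.List using (List; []; _∷_; _++_; map; replicate)
  open import Data.List.Membership.Propositional using (_∈_; _∉_)
  open import Data.List.Relation.Unary.Any using (here; there)
  import Data.List.Relation.Unary.All as All
  open import Data.List.Relation.Unary.All.Properties using (All¬⇒¬Any)
  open import Data.List.Relation.Unary.AllPairs using (_∷_)
  open import Data.List.Relation.Unary.Unique.Propositional using (Unique)
  open import Data.List.Relation.Binary.Permutation.Propositional as ↭ using (_↭_)
  open import Function using (_∘_)
  open import Relation.Binary.PropositionalEquality
    using (_≡_; _≢_; refl; sym; trans; cong; cong₂; subst; module ≡-Reasoning)
  open ≡-Reasoning
  open Sums
  open Membership

  forbidden : Sign → List ℤ → List ℤ → List ℤ
  forbidden pos Fp Fn = Fp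
  forbidden neg Fp Fn = Fn

  edgeSign : Sign → Sign → Sign
  edgeSign pos _ = pos
  edgeSign neg s = s

  edgeSign-comm : ∀ s t → edgeSign s t ≡ edgeSign t s
  edgeSign-comm pos pos = refl
  edgeSign-comm pos neg = refl
  edgeSign-comm neg pos = refl
  edgeSign-comm neg neg = refl

  ·-flip : ∀ σ {x y} → y ≡ σ · x → x ≡ σ · y
  ·-flip pos y≡x  = sym y≡x
  ·-flip neg {x} y≡-x = trans (sym (neg-involutive x)) (cong -_ (sym y≡-x))

  ==-edgeSign : ∀ t s x y → (y == edgeSign t s · x) ≡ (x == edgeSign s t · y)
  ==-edgeSign t s x y = trans (==-⇔ (·-flip (edgeSign t s)) (·-flip (edgeSign t s)))
                              (cong (λ σ → x == σ · y) (edgeSign-comm t s))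

  forbidden-∷ : ∀ t s x Fp Fn → forbidden t (x ∷ Fp) (s · x ∷ Fn) ≡ edgeSign t s · x ∷ forbidden t Fp Fn
  forbidden-∷ pos s x Fp Fn = refl
  forbidden-∷ neg s x Fp Fn = refl

  -- Vertices of +K m (kind pos) and of -K n (kind neg) are coloured one at a time from L;
  -- Fp (resp. Fn) lists the colours forbidden to the next vertex of kind pos (resp. neg).
  count : List ℤ → List ℤ → List ℤ → List Sign → ℕ
  count L Fp Fn []       = 1
  count L Fp Fn (s ∷ ss) =
    sumOver (λ x → if x ∈ᵇ forbidden s Fp Fn then 0 else count L (x ∷ Fp) (s · x ∷ Fn) ss) L

  kinds : ℕ → ℕ → List Sign
  kinds m n = replicate m pos ++ replicate n neg

  forbidden-agree : ∀ {L Fp Fn Gp Gn} s → AgreeOn L Fp Gp → AgreeOn L Fn Gn →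
    AgreeOn L (forbidden s Fp Fn) (forbidden s Gp Gn)
  forbidden-agree pos Fp≈Gp Fn≈Gn = Fp≈Gp
  forbidden-agree neg Fp≈Gp Fn≈Gn = Fn≈Gn

  count-cong : ∀ {L Fp Fn Gp Gn} ts → AgreeOn L Fp Gp → AgreeOn L Fn Gn → count L Fp Fn ts ≡ count L Gp Gn ts
  count-cong       []       Fp≈Gp Fn≈Gn = refl
  count-cong {L} (s ∷ ts) Fp≈Gp Fn≈Gn = sumOver-cong L λ {x} x∈L →
    cong₂ (λ b c → if b then 0 else c) (∈ᵇ-agree (forbidden-agree s Fp≈Gp Fn≈Gn) x∈L)
          (count-cong ts (agree-∷ x Fp≈Gp) (agree-∷ (s · x) Fn≈Gn))

  count-∷-cong : ∀ L s {ts ts′} → (∀ {Fp Fn} → count L Fp Fn ts ≡ count L Fp Fn ts′) →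
    ∀ {Fp Fn} → count L Fp Fn (s ∷ ts) ≡ count L Fp Fn (s ∷ ts′)
  count-∷-cong L s eq = sumOver-cong L (λ _ → cong (λ c → if _ then 0 else c) eq)

  count-swap : ∀ L Fp Fn s t ts → count L Fp Fn (s ∷ t ∷ ts) ≡ count L Fp Fn (t ∷ s ∷ ts)
  count-swap L Fp Fn s t ts = begin
    sumOver (λ x → if a x then 0 else sumOver (λ y → if y ∈ᵇ Ft x then 0 else c y x) L) L
      ≡⟨ sumOver-cong L (λ {x} _ → sumOver-if (a x) _ L) ⟩
    sumOver (λ x → sumOver (λ y → if a x then 0 else if y ∈ᵇ Ft x then 0 else c y x) L) L
      ≡⟨ sumOver-swap _ L L ⟩
    sumOver (λ y → sumOver (λ x → if a x then 0 else if y ∈ᵇ Ft x then 0 else c y x) L) L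
      ≡⟨ sumOver-cong L (λ {y} _ → sumOver-cong L (λ {x} _ → guards x y)) ⟩
    sumOver (λ y → sumOver (λ x → if b y then 0 else if x ∈ᵇ Fs y then 0 else c′ x y) L) L
      ≡⟨ sumOver-cong L (λ {y} _ → sym (sumOver-if (b y) _ L)) ⟩
    sumOver (λ y → if b y then 0 else sumOver (λ x → if x ∈ᵇ Fs y then 0 else c′ x y) L) L ∎
    where
    a b : ℤ → Bool
    a x = x ∈ᵇ forbidden s Fp Fn
    b y = y ∈ᵇ forbidden t Fp Fn
    Ft Fs : ℤ → List ℤ
    Ft x = forbidden t (x ∷ Fp) (s · x ∷ Fn)
    Fs y = forbidden s (y ∷ Fp) (t · y ∷ Fn)
    c c′ : ℤ → ℤ → ℕ
    c  y x = count L (y ∷ x ∷ Fp) (t · y ∷ s · x ∷ Fn) ts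
    c′ x y = count L (x ∷ y ∷ Fp) (s · x ∷ t · y ∷ Fn) ts
    guards : ∀ x y → (if a x then 0 else if y ∈ᵇ Ft x then 0 else c y x)
                   ≡ (if b y then 0 else if x ∈ᵇ Fs y then 0 else c′ x y)
    guards x y rewrite forbidden-∷ t s x Fp Fn | forbidden-∷ s t y Fp Fn | ==-edgeSign t s x y =
      trans (if-guards-swap (a x) (b y) (x == edgeSign s t · y))
            (cong (λ z → if b y then 0 else if (x == edgeSign s t · y) ∨ a x then 0 else z)
                  (count-cong ts (agree-swap y x Fp) (agree-swap (t · y) (s · x) Fn)))

  count-↭ : ∀ L {ts ts′} → ts ↭ ts′ → ∀ {Fp Fn} → count L Fp Fn ts ≡ count L Fp Fn ts′
  count-↭ L ↭.refl                                    = refl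
  count-↭ L {_ ∷ xs} {_ ∷ ys} (↭.prep s p)            = count-∷-cong L s {xs} {ys} (count-↭ L p)
  count-↭ L {_ ∷ _ ∷ xs} {_ ∷ _ ∷ ys} (↭.swap s t p) {Fp} {Fn} =
    trans (count-swap L Fp Fn s t xs)
          (count-∷-cong L t {s ∷ xs} {s ∷ ys} (count-∷-cong L s {xs} {ys} (count-↭ L p)))
  count-↭ L (↭.trans p q)                             = trans (count-↭ L p) (count-↭ L q)

  count-colours : ∀ {L L′} → (∀ f → sumOver f L ≡ sumOver f L′) →
    ∀ Fp Fn ts → count L Fp Fn ts ≡ count L′ Fp Fn ts
  count-colours same Fp Fn []           = refl
  count-colours {L} same Fp Fn (s ∷ ts) =
    trans (sumOver-cong L (λ _ → cong (λ c → if _ then 0 else c) (count-colours same _ _ ts))) (same _)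

  _↓_ : ℕ → ℕ → ℕ
  t ↓ zero  = 1
  t ↓ suc m = t * (pred t ↓ m)

  free : List ℤ → List ℤ → ℕ
  free L F = sumOver (λ x → if x ∈ᵇ F then 0 else 1) L

  free-∷ : ∀ {L x} F → Unique L → x ∈ L → (x ∈ᵇ F) ≡ false → free L F ≡ suc (free L (x ∷ F))
  free-∷ {y ∷ L} F (y∉L ∷ _) (here refl) y∉F rewrite y∉F | ==-refl y =
    cong suc (sumOver-cong L (λ z∈L → cong (λ b → if b then 0 else 1)
                                           (sym (∈ᵇ-agree (agree-absent F (All¬⇒¬Any y∉L)) z∈L))))
  free-∷ {y ∷ L} {x} F (y∉L ∷ uniq) (there x∈L) x∉F rewrite ==-≢ (All.lookup y∉L x∈L) =
    trans (cong₂ _+_ refl (free-∷ F uniq x∈L x∉F)) (+-suc _ _)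

  count-replicate-pos : ∀ {L} → Unique L → ∀ m Fp Fn → count L Fp Fn (replicate m pos) ≡ free L Fp ↓ m
  count-replicate-pos uniq zero    Fp Fn = refl
  count-replicate-pos {L} uniq (suc m) Fp Fn =
    trans (sumOver-cong L colour) (sumOver-if-const (_∈ᵇ Fp) (pred (free L Fp) ↓ m) L)
    where
    colour : ∀ {x} → x ∈ L → (if x ∈ᵇ Fp then 0 else count L (x ∷ Fp) (x ∷ Fn) (replicate m pos))
                            ≡ (if x ∈ᵇ Fp then 0 else pred (free L Fp) ↓ m)
    colour {x} x∈L with x ∈ᵇ Fp in x∉Fp
    ... | true  = refl
    ... | false = trans (count-replicate-pos uniq m (x ∷ Fp) (x ∷ Fn))
                        (cong (λ t → pred t ↓ m) (sym (free-∷ Fp uniq x∈L x∉Fp)))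

  deletions : ∀ {A : Set} → List A → List (List A)
  deletions []       = []
  deletions (x ∷ xs) = xs ∷ map (x ∷_) (deletions xs)

  ·-zero : ∀ s → s · +0 ≡ +0
  ·-zero pos = refl
  ·-zero neg = refl

  0≢· : ∀ s {x} → +0 ≢ x → +0 ≢ s · x
  0≢· pos 0≢x = 0≢x
  0≢· neg {x} 0≢x 0≡-x = 0≢x (trans (cong -_ 0≡-x) (neg-involutive x))

  forbidden-both : ∀ s {y} Fp Fn {b} → (y ∈ᵇ Fp) ≡ b → (y ∈ᵇ Fn) ≡ b → (y ∈ᵇ forbidden s Fp Fn) ≡ b
  forbidden-both pos Fp Fn inFp inFn = inFp
  forbidden-both neg Fp Fn inFp inFn = inFn

  count-zero-forbidden : ∀ {L} Fp Fn ts → (+0 ∈ᵇ Fp) ≡ true → (+0 ∈ᵇ Fn) ≡ true →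
    count (+0 ∷ L) Fp Fn ts ≡ count L Fp Fn ts
  count-zero-forbidden Fp Fn []           0∈Fp 0∈Fn = refl
  count-zero-forbidden {L} Fp Fn (s ∷ ts) 0∈Fp 0∈Fn =
    cong₂ _+_ (cong (λ b → if b then 0 else count (+0 ∷ L) (+0 ∷ Fp) (s · +0 ∷ Fn) ts)
                    (forbidden-both s Fp Fn 0∈Fp 0∈Fn))
              (sumOver-cong L (λ {x} _ → cong (λ c → if _ then 0 else c)
                (count-zero-forbidden (x ∷ Fp) (s · x ∷ Fn) ts
                                      (∈ᵇ-there x Fp 0∈Fp) (∈ᵇ-there (s · x) Fn 0∈Fn))))

  -- The colour 0 can be used at most once, and deleting the vertex that uses it leaves a
  -- colouring from L of the remaining vertices.
  count-zero : ∀ {L} → +0 ∉ L → ∀ {Fp Fn} ts → (+0 ∈ᵇ Fp) ≡ false → (+0 ∈ᵇ Fn) ≡ false →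
    count (+0 ∷ L) Fp Fn ts ≡ count L Fp Fn ts + sumOver (count L Fp Fn) (deletions ts)
  count-zero 0∉L []                   0∉Fp 0∉Fn = refl
  count-zero {L} 0∉L {Fp} {Fn} (s ∷ ts) 0∉Fp 0∉Fn = begin
    (if +0 ∈ᵇ F then 0 else count (+0 ∷ L) (+0 ∷ Fp) (s · +0 ∷ Fn) ts)
      + sumOver (λ x → if x ∈ᵇ F then 0 else count (+0 ∷ L) (x ∷ Fp) (s · x ∷ Fn) ts) L
      ≡⟨ cong₂ _+_ dropZero (sumOver-cong L (λ x∈L → cong (λ c → if _ then 0 else c) (recurse x∈L))) ⟩
    count L Fp Fn ts + sumOver (λ x → if x ∈ᵇ F then 0 else count L (x ∷ Fp) (s · x ∷ Fn) ts + deleted x) L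
      ≡⟨ cong (count L Fp Fn ts +_) (trans (sumOver-cong L (λ {x} _ → if-+ (x ∈ᵇ F))) (sumOver-+ _ _ L)) ⟩
    count L Fp Fn ts + (count L Fp Fn (s ∷ ts) + sumOver (λ x → if x ∈ᵇ F then 0 else deleted x) L)
      ≡⟨ cong (λ z → count L Fp Fn ts + (count L Fp Fn (s ∷ ts) + z)) deletedFirst ⟩
    count L Fp Fn ts + (count L Fp Fn (s ∷ ts) + sumOver (count L Fp Fn) (map (s ∷_) (deletions ts)))
      ≡⟨ x∙yz≈y∙xz (count L Fp Fn ts) (count L Fp Fn (s ∷ ts)) _ ⟩
    count L Fp Fn (s ∷ ts) + sumOver (count L Fp Fn) (deletions (s ∷ ts)) ∎
    where
    F : List ℤ
    F = forbidden s Fp Fn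
    deleted : ℤ → ℕ
    deleted x = sumOver (count L (x ∷ Fp) (s · x ∷ Fn)) (deletions ts)
    dropZero : (if +0 ∈ᵇ F then 0 else count (+0 ∷ L) (+0 ∷ Fp) (s · +0 ∷ Fn) ts) ≡ count L Fp Fn ts
    dropZero =
      trans (cong₂ (λ b z → if b then 0 else count (+0 ∷ L) (+0 ∷ Fp) (z ∷ Fn) ts)
                   (forbidden-both s Fp Fn 0∉Fp 0∉Fn) (·-zero s))
      (trans (count-zero-forbidden (+0 ∷ Fp) (+0 ∷ Fn) ts (∈ᵇ-here +0 Fp) (∈ᵇ-here +0 Fn))
             (count-cong ts (agree-absent Fp 0∉L) (agree-absent Fn 0∉L)))
    recurse : ∀ {x} → x ∈ L →
      count (+0 ∷ L) (x ∷ Fp) (s · x ∷ Fn) ts ≡ count L (x ∷ Fp) (s · x ∷ Fn) ts + deleted x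
    recurse {x} x∈L = count-zero 0∉L ts (∈ᵇ-∷-false Fp 0≢x 0∉Fp) (∈ᵇ-∷-false Fn (0≢· s 0≢x) 0∉Fn)
      where
      0≢x : +0 ≢ x
      0≢x 0≡x = 0∉L (subst (_∈ L) (sym 0≡x) x∈L)
    deletedFirst : sumOver (λ x → if x ∈ᵇ F then 0 else deleted x) L
                   ≡ sumOver (count L Fp Fn) (map (s ∷_) (deletions ts))
    deletedFirst = trans (sumOver-cong L (λ {x} _ → sumOver-if (x ∈ᵇ F) _ (deletions ts)))
                   (trans (sumOver-swap _ L (deletions ts))
                          (sym (sumOver-map (count L Fp Fn) (s ∷_) (deletions ts))))

  *-pred-suc : ∀ n (h : ℕ → ℕ) → n * h (suc (pred n)) ≡ n * h n
  *-pred-suc zero    h = refl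
  *-pred-suc (suc n) h = refl

  sumOver-deletions-replicate : ∀ {A : Set} (g : List A → ℕ) n s →
    sumOver g (deletions (replicate n s)) ≡ n * g (replicate (pred n) s)
  sumOver-deletions-replicate g zero    s = refl
  sumOver-deletions-replicate g (suc n) s = cong (g (replicate n s) +_) (begin
    sumOver g (map (s ∷_) (deletions (replicate n s))) ≡⟨ sumOver-map g (s ∷_) (deletions (replicate n s)) ⟩
    sumOver (g ∘ (s ∷_)) (deletions (replicate n s))  ≡⟨ sumOver-deletions-replicate (g ∘ (s ∷_)) n s ⟩
    n * g (s ∷ replicate (pred n) s)                  ≡⟨ *-pred-suc n (λ k → g (replicate k s)) ⟩
    n * g (replicate n s)                             ∎)

  sumOver-deletions-kinds : ∀ (g : List Sign → ℕ) m n →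
    sumOver g (deletions (kinds m n)) ≡ m * g (kinds (pred m) n) + n * g (kinds m (pred n))
  sumOver-deletions-kinds g zero    n = sumOver-deletions-replicate g n neg
  sumOver-deletions-kinds g (suc m) n = begin
    g (kinds m n) + sumOver g (map (pos ∷_) (deletions (kinds m n)))
      ≡⟨ cong (g (kinds m n) +_) (trans (sumOver-map g (pos ∷_) (deletions (kinds m n)))
                                        (sumOver-deletions-kinds (g ∘ (pos ∷_)) m n)) ⟩
    g (kinds m n) + (m * g (pos ∷ kinds (pred m) n) + n * g (kinds (suc m) (pred n)))
      ≡⟨ cong (λ z → g (kinds m n) + (z + n * g (kinds (suc m) (pred n))))
              (*-pred-suc m (λ k → g (kinds k n))) ⟩
    g (kinds m n) + (m * g (kinds m n) + n * g (kinds (suc m) (pred n)))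
      ≡⟨ sym (+-assoc (g (kinds m n)) _ _) ⟩
    suc m * g (kinds m n) + n * g (kinds (suc m) (pred n)) ∎

module Properness where
  open import Defs
    using (Sign; pos; neg; _·_; SignedGraph; order; edge; symm; noLoop; completeEdge; +K; -K; _∨₊_;
           allᵇ; allVecs; properᵇ; chrom; C)
  open import Data.Bool using (Bool; true; false; not; _∨_; if_then_else_)
  open import Data.Bool.Properties using (not-injective; ∨-conicalˡ; ∨-conicalʳ; if-float)
  open import Data.Nat using (ℕ; zero; suc; _+_)
  open import Data.Fin using (Fin; zero; suc; splitAt)
  import Data.Fin as Fin
  open import Data.Integer using (ℤ)
  open import Data.Maybe using (Maybe; just; nothing)
  open import Data.Maybe.Properties using (just-injective)
  open import Data.Sum using (inj₁; inj₂)
  open import Data.Product using (_×_; _,_; proj₁; proj₂; ∃)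
  open import Data.Unit using (⊤; tt)
  open import Data.List as List using (List; []; _∷_; map; concatMap; allFin)
  open import Data.List.Membership.Propositional using (_∈_)
  open import Data.List.Membership.Propositional.Properties using (∈-allFin)
  open import Data.List.Relation.Unary.Any using (here; there)
  open import Data.Vec as Vec using (Vec; []; _∷_; lookup; toList)
  open import Data.Vec.Properties using (lookup-replicate; toList-++; toList-replicate)
  open import Function using (case_of_)
  open import Function.Bundles using (_⇔_; mk⇔; Equivalence)
  open import Function.Properties.Equivalence using () renaming (trans to ⇔-trans; sym to ⇔-sym)
  open import Relation.Nullary using (yes; no)
  open import Relation.Nullary.Negation using (contradiction)
  open import Relation.Binary.PropositionalEquality
    using (_≡_; _≢_; refl; sym; trans; cong; cong₂; subst; module ≡-Reasoning)
  open ≡-Reasoning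
  open Sums
  open Membership
  open Counting

  Proper : ∀ {N} → (Fin N → Fin N → Maybe Sign) → Vec ℤ N → Set
  Proper e κ = ∀ v w {s} → e v w ≡ just s → lookup κ v ≢ s · lookup κ w

  allᵇ-true : ∀ {A : Set} {p : A → Bool} {xs x} → allᵇ p xs ≡ true → x ∈ xs → p x ≡ true
  allᵇ-true {p = p} {y ∷ xs} all-p (here refl) with p y | all-p
  ... | true | _ = refl
  allᵇ-true {p = p} {y ∷ xs} all-p (there x∈xs) with p y | all-p
  ... | true | all-p′ = allᵇ-true all-p′ x∈xs

  allᵇ-false : ∀ {A : Set} {p : A → Bool} xs → allᵇ p xs ≡ false → ∃ λ x → p x ≡ false
  allᵇ-false             []       ()
  allᵇ-false {p = p} (y ∷ xs) not-all with p y in py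
  ... | false = y , py
  ... | true  = allᵇ-false xs not-all

  allᵇ²-false : ∀ {A : Set} (P : A → A → Bool) xs → allᵇ (λ v → allᵇ (P v) xs) xs ≡ false →
    ∃ λ v → ∃ λ w → P v w ≡ false
  allᵇ²-false P xs not-all with allᵇ-false xs not-all
  ... | v , not-all-v with allᵇ-false xs not-all-v
  ... | w , not-vw = v , w , not-vw

  not-==⇒≢ : ∀ {x y} → not (x == y) ≡ true → x ≢ y
  not-==⇒≢ {x} {y} h = ==-false⇒≢ (not-injective {y = false} h)

  properᵇ⇔Proper : ∀ G κ → properᵇ G κ ≡ true ⇔ Proper (edge G) κ
  properᵇ⇔Proper G κ = mk⇔ sound complete
    where
    sound : properᵇ G κ ≡ true → Proper (edge G) κ
    sound ok v w {s} e with allᵇ-true (allᵇ-true ok (∈-allFin v)) (∈-allFin w)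
    ... | ok-vw with edge G v w | e
    ... | just .s | refl = not-==⇒≢ ok-vw
    complete : Proper (edge G) κ → properᵇ G κ ≡ true
    complete proper with properᵇ G κ in not-ok
    ... | true  = refl
    ... | false with allᵇ²-false {Fin (order G)} _ (allFin (order G)) not-ok
    ... | v , w , not-ok-vw with edge G v w in e | not-ok-vw
    ... | just s | clash = contradiction (==-sound (not-injective {y = true} clash)) (proper v w e)

  Proper-∷ : ∀ {N} (e : Fin (suc N) → Fin (suc N) → Maybe Sign) s₀ x κ →
    (∀ v w → e v w ≡ e w v) → (∀ v → e v v ≡ nothing) → (∀ w → e zero (suc w) ≡ just s₀) →
    Proper e (x ∷ κ) ⇔ ((∀ w → x ≢ s₀ · lookup κ w) × Proper (λ v w → e (suc v) (suc w)) κ)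
  Proper-∷ e s₀ x κ e-symm e-loop e-row = mk⇔ (λ proper → (λ w → proper zero (suc w) (e-row w)) ,
                                                         (λ v w → proper (suc v) (suc w)))
                                             back
    where
    back : (∀ w → x ≢ s₀ · lookup κ w) × Proper (λ v w → e (suc v) (suc w)) κ → Proper e (x ∷ κ)
    back (row , tail) zero    zero    e00 = case trans (sym (e-loop zero)) e00 of λ ()
    back (row , tail) zero    (suc w) e0w with just-injective (trans (sym (e-row w)) e0w)
    ... | refl = row w
    back (row , tail) (suc v) zero    ev0
      with just-injective (trans (sym (trans (e-symm (suc v) zero) (e-row v))) ev0)
    ... | refl = λ κv≡s₀x → row v (·-flip s₀ κv≡s₀x)
    back (row , tail) (suc v) (suc w) evw = tail v w evw

  Proper-cong : ∀ {N} {e e′ : Fin N → Fin N → Maybe Sign} κ → (∀ v w → e v w ≡ e′ v w) →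
    Proper e κ ⇔ Proper e′ κ
  Proper-cong κ e≗e′ = mk⇔ (λ proper v w {_} eq → proper v w (trans (e≗e′ v w) eq))
                           (λ proper v w {_} eq → proper v w (trans (sym (e≗e′ v w)) eq))

  complete-suc : ∀ {n} s (v w : Fin n) → completeEdge s (suc v) (suc w) ≡ completeEdge s v w
  complete-suc s v w with v Fin.≟ w
  ... | yes _ = refl
  ... | no  _ = refl

  join-row : ∀ m n (w : Fin (m + n)) → edge (+K (suc m) ∨₊ -K n) zero (suc w) ≡ just pos
  join-row m n w with splitAt m w
  ... | inj₁ _ = refl
  ... | inj₂ _ = refl

  join-tail : ∀ m n (v w : Fin (m + n)) →
    edge (+K (suc m) ∨₊ -K n) (suc v) (suc w) ≡ edge (+K m ∨₊ -K n) v w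
  join-tail m n v w with splitAt m v | splitAt m w
  ... | inj₁ a | inj₁ b = complete-suc pos a b
  ... | inj₁ _ | inj₂ _ = refl
  ... | inj₂ _ | inj₁ _ = refl
  ... | inj₂ _ | inj₂ _ = refl

  Pairwise : ∀ {N} → Vec Sign N → Vec ℤ N → Set
  Pairwise []       []      = ⊤
  Pairwise (s ∷ ss) (x ∷ κ) = (∀ i → x ≢ edgeSign s (lookup ss i) · lookup κ i) × Pairwise ss κ

  kindsᵛ : ∀ m n → Vec Sign (m + n)
  kindsᵛ m n = Vec.replicate m pos Vec.++ Vec.replicate n neg

  Proper⇔Pairwise : ∀ m n κ → Proper (edge (+K m ∨₊ -K n)) κ ⇔ Pairwise (kindsᵛ m n) κ
  Proper⇔Pairwise zero    zero    []      = mk⇔ (λ _ → tt) (λ _ ())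
  Proper⇔Pairwise zero    (suc n) (x ∷ κ) =
    ⇔-trans (Proper-∷ _ neg x κ (symm G) (noLoop G) (λ _ → refl))
            (mk⇔ (λ (row , tail) → row′ row , Equivalence.to tail⇔ tail)
                 (λ (row , pw) → unrow row , Equivalence.from tail⇔ pw))
    where
    G : SignedGraph
    G = +K zero ∨₊ -K (suc n)
    tail⇔ : Proper (λ v w → edge G (suc v) (suc w)) κ ⇔ Pairwise (kindsᵛ zero n) κ
    tail⇔ = ⇔-trans (Proper-cong κ (complete-suc neg)) (Proper⇔Pairwise zero n κ)
    row′ : (∀ i → x ≢ neg · lookup κ i) → ∀ i → x ≢ edgeSign neg (lookup (Vec.replicate n neg) i) · lookup κ i
    row′ row i = subst (λ σ → x ≢ σ · lookup κ i) (sym (lookup-replicate i neg)) (row i)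
    unrow : (∀ i → x ≢ edgeSign neg (lookup (Vec.replicate n neg) i) · lookup κ i) → ∀ i → x ≢ neg · lookup κ i
    unrow row i = subst (λ σ → x ≢ σ · lookup κ i) (lookup-replicate i neg) (row i)
  Proper⇔Pairwise (suc m) n       (x ∷ κ) =
    ⇔-trans (Proper-∷ _ pos x κ (symm G) (noLoop G) (join-row m n))
            (mk⇔ (λ (row , tail) → row , Equivalence.to tail⇔ tail)
                 (λ (row , pw) → row , Equivalence.from tail⇔ pw))
    where
    G : SignedGraph
    G = +K (suc m) ∨₊ -K n
    tail⇔ : Proper (λ v w → edge G (suc v) (suc w)) κ ⇔ Pairwise (kindsᵛ m n) κ
    tail⇔ = ⇔-trans (Proper-cong κ (join-tail m n)) (Proper⇔Pairwise m n κ)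

  valid : ∀ {N} → Vec Sign N → List ℤ → List ℤ → Vec ℤ N → Bool
  valid []       Fp Fn []      = true
  valid (s ∷ ss) Fp Fn (x ∷ κ) =
    if x ∈ᵇ forbidden s Fp Fn then false else valid ss (x ∷ Fp) (s · x ∷ Fn) κ

  Avoids : ∀ {N} → Vec Sign N → List ℤ → List ℤ → Vec ℤ N → Set
  Avoids ss Fp Fn κ = ∀ i → (lookup κ i ∈ᵇ forbidden (lookup ss i) Fp Fn) ≡ false

  ∉forbidden-∷ : ∀ t s x y Fp Fn →
    (y ∈ᵇ forbidden t (x ∷ Fp) (s · x ∷ Fn)) ≡ false ⇔ (x ≢ edgeSign s t · y × (y ∈ᵇ forbidden t Fp Fn) ≡ false)
  ∉forbidden-∷ t s x y Fp Fn rewrite forbidden-∷ t s x Fp Fn | ==-edgeSign t s x y = mk⇔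
    (λ y∉ → ==-false⇒≢ (∨-conicalˡ _ _ y∉) , ∨-conicalʳ _ _ y∉)
    (λ (x≢ , y∉F) → trans (cong (_∨ _) (==-≢ x≢)) y∉F)

  valid⇔ : ∀ {N} (ss : Vec Sign N) Fp Fn κ →
    valid ss Fp Fn κ ≡ true ⇔ (Pairwise ss κ × Avoids ss Fp Fn κ)
  valid⇔ []       Fp Fn []      = mk⇔ (λ _ → tt , λ ()) (λ _ → refl)
  valid⇔ (s ∷ ss) Fp Fn (x ∷ κ) with x ∈ᵇ forbidden s Fp Fn in x∈F
  ... | true  = mk⇔ (λ ()) (λ (_ , avoids) → case trans (sym x∈F) (avoids zero) of λ ())
  ... | false = ⇔-trans (valid⇔ ss (x ∷ Fp) (s · x ∷ Fn) κ) (mk⇔ to from)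
    where
    at : ∀ i → (lookup κ i ∈ᵇ forbidden (lookup ss i) (x ∷ Fp) (s · x ∷ Fn)) ≡ false
                ⇔ (x ≢ edgeSign s (lookup ss i) · lookup κ i
                   × (lookup κ i ∈ᵇ forbidden (lookup ss i) Fp Fn) ≡ false)
    at i = ∉forbidden-∷ (lookup ss i) s x (lookup κ i) Fp Fn
    to : Pairwise ss κ × Avoids ss (x ∷ Fp) (s · x ∷ Fn) κ →
         Pairwise (s ∷ ss) (x ∷ κ) × Avoids (s ∷ ss) Fp Fn (x ∷ κ)
    to (pw , avoids) = ((λ i → proj₁ (Equivalence.to (at i) (avoids i))) , pw) ,
                       λ { zero → x∈F ; (suc i) → proj₂ (Equivalence.to (at i) (avoids i)) }
    from : Pairwise (s ∷ ss) (x ∷ κ) × Avoids (s ∷ ss) Fp Fn (x ∷ κ) →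
           Pairwise ss κ × Avoids ss (x ∷ Fp) (s · x ∷ Fn) κ
    from ((row , pw) , avoids) = pw , λ i → Equivalence.from (at i) (row i , avoids (suc i))

  ≡true⇔⇒≡ : ∀ {a b} → (a ≡ true ⇔ b ≡ true) → a ≡ b
  ≡true⇔⇒≡ {true}          a⇔b = sym (Equivalence.to a⇔b refl)
  ≡true⇔⇒≡ {false} {false} a⇔b = refl
  ≡true⇔⇒≡ {false} {true}  a⇔b = Equivalence.from a⇔b refl

  ∉forbidden-[] : ∀ s y → (y ∈ᵇ forbidden s [] []) ≡ false
  ∉forbidden-[] pos y = refl
  ∉forbidden-[] neg y = refl

  properᵇ≡valid : ∀ m n κ → properᵇ (+K m ∨₊ -K n) κ ≡ valid (kindsᵛ m n) [] [] κ
  properᵇ≡valid m n κ = ≡true⇔⇒≡ (⇔-trans (properᵇ⇔Proper _ κ) (⇔-trans (Proper⇔Pairwise m n κ)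
    (⇔-sym (⇔-trans (valid⇔ (kindsᵛ m n) [] [] κ) (mk⇔ proj₁ (λ pw → pw , nothing-forbidden))))))
    where
    nothing-forbidden : Avoids (kindsᵛ m n) [] [] κ
    nothing-forbidden i = ∉forbidden-[] (lookup (kindsᵛ m n) i) (lookup κ i)

  count-valid : ∀ {N} L (ss : Vec Sign N) Fp Fn →
    sumOver (λ κ → if valid ss Fp Fn κ then 1 else 0) (allVecs N L) ≡ count L Fp Fn (toList ss)
  count-valid L []                   Fp Fn = refl
  count-valid {suc N} L (s ∷ ss) Fp Fn = begin
    sumOver indicator (concatMap (λ x → map (x ∷_) (allVecs N L)) L)
      ≡⟨ sumOver-concatMap indicator (λ x → map (x ∷_) (allVecs N L)) L ⟩
    sumOver (λ x → sumOver indicator (map (x ∷_) (allVecs N L))) L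
      ≡⟨ sumOver-cong L (λ {x} _ → trans (sumOver-map indicator (x ∷_) (allVecs N L)) (colour x)) ⟩
    count L Fp Fn (s ∷ toList ss) ∎
    where
    indicator : Vec ℤ (suc N) → ℕ
    indicator κ = if valid (s ∷ ss) Fp Fn κ then 1 else 0
    colour : ∀ x → sumOver (λ κ → indicator (x ∷ κ)) (allVecs N L)
                   ≡ (if x ∈ᵇ forbidden s Fp Fn then 0 else count L (x ∷ Fp) (s · x ∷ Fn) (toList ss))
    colour x = begin
      sumOver (λ κ → indicator (x ∷ κ)) (allVecs N L)
        ≡⟨ sumOver-cong (allVecs N L) (λ _ → if-float (λ b → if b then 1 else 0) x∈F) ⟩
      sumOver (λ κ → if x∈F then 0 else rest κ) (allVecs N L)
        ≡⟨ sym (sumOver-if x∈F rest (allVecs N L)) ⟩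
      (if x∈F then 0 else sumOver rest (allVecs N L))
        ≡⟨ cong (λ c → if x∈F then 0 else c) (count-valid L ss (x ∷ Fp) (s · x ∷ Fn)) ⟩
      (if x∈F then 0 else count L (x ∷ Fp) (s · x ∷ Fn) (toList ss)) ∎
      where
      x∈F : Bool
      x∈F = x ∈ᵇ forbidden s Fp Fn
      rest : Vec ℤ N → ℕ
      rest κ = if valid ss (x ∷ Fp) (s · x ∷ Fn) κ then 1 else 0

  chrom≡count : ∀ m n q → chrom (+K m ∨₊ -K n) q ≡ count (C q) [] [] (kinds m n)
  chrom≡count m n q = begin
    chrom (+K m ∨₊ -K n) q
      ≡⟨ length-filterᵇ (properᵇ (+K m ∨₊ -K n)) (allVecs (m + n) (C q)) ⟩
    sumOver (λ κ → if properᵇ (+K m ∨₊ -K n) κ then 1 else 0) (allVecs (m + n) (C q))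
      ≡⟨ sumOver-cong (allVecs (m + n) (C q))
                      (λ {κ} _ → cong (λ b → if b then 1 else 0) (properᵇ≡valid m n κ)) ⟩
    sumOver (λ κ → if valid (kindsᵛ m n) [] [] κ then 1 else 0) (allVecs (m + n) (C q))
      ≡⟨ count-valid (C q) (kindsᵛ m n) [] [] ⟩
    count (C q) [] [] (toList (kindsᵛ m n))
      ≡⟨ cong (count (C q) [] []) (trans (toList-++ (Vec.replicate m pos) _)
                                         (cong₂ List._++_ (toList-replicate m pos) (toList-replicate n neg))) ⟩
    count (C q) [] [] (kinds m n) ∎

module PairColours where
  open import Defs using (pos; neg; _·_; C)
  open import Data.Bool using (Bool; true; false; _∨_; _∧_; if_then_else_)
  open import Data.Bool.Properties using (∨-zeroʳ)
  open import Data.Nat using (ℕ; zero; suc; pred; _+_; _*_; _<_; _%_; _/_; _≟_)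
  open import Data.Nat.Properties using (+-identityʳ; *-comm; *-assoc; n<1+n; <-trans; <-irrefl)
  open import Data.Nat.DivMod using (m*n%n≡0; m*n/n≡m; [m+kn]%n≡m%n; +-distrib-/-∣ʳ)
  open import Data.Nat.Divisibility using (divides)
  open import Data.Integer using (ℤ; +0; +[1+_]; -[1+_]; -_; ∣_∣)
  open import Data.List using (List; []; _∷_; _++_; map; concatMap; replicate; upTo; downFrom)
  open import Data.List.Properties using (reverse-upTo)
  open import Data.List.Membership.Propositional using (_∉_)
  open import Data.List.Relation.Unary.Any using (there)
  open import Data.List.Relation.Unary.All using (All; []; _∷_)
  open import Data.List.Relation.Unary.AllPairs using ([]; _∷_)
  open import Data.List.Relation.Unary.Unique.Propositional using (Unique)
  open import Data.List.Relation.Binary.Permutation.Propositional using (_↭_; ↭-sym)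
  open import Data.List.Relation.Binary.Permutation.Propositional.Properties using (↭-reverse; ++-comm)
  open import Function using (_∘′_)
  open import Relation.Nullary using (yes; no)
  open import Relation.Binary.PropositionalEquality
    using (_≡_; _≢_; refl; sym; trans; cong; cong₂; subst; module ≡-Reasoning)
  open ≡-Reasoning
  open Sums
  open Membership
  open Counting

  pair : ℕ → List ℤ
  pair j = +[1+ j ] ∷ -[1+ j ] ∷ []

  pairs : ℕ → List ℤ
  pairs K = concatMap pair (downFrom K)

  +0∉pairs : ∀ K → +0 ∉ pairs K
  +0∉pairs (suc K) (there (there 0∈)) = +0∉pairs K 0∈

  pairs-avoid : ∀ {K c} → K < ∣ c ∣ → All (c ≢_) (pairs K)
  pairs-avoid {zero}      K<∣c∣ = []
  pairs-avoid {suc K} {c} K<∣c∣ = fresh refl ∷ fresh refl ∷ pairs-avoid (<-trans (n<1+n K) K<∣c∣)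
    where
    fresh : ∀ {d} → ∣ d ∣ ≡ suc K → c ≢ d
    fresh ∣d∣≡ c≡d = <-irrefl (sym (trans (cong ∣_∣ c≡d) ∣d∣≡)) K<∣c∣

  pairs-unique : ∀ K → Unique (pairs K)
  pairs-unique zero    = []
  pairs-unique (suc K) = ((λ ()) ∷ pairs-avoid (n<1+n K)) ∷ pairs-avoid (n<1+n K) ∷ pairs-unique K

  sumOver-pairs : ∀ (f : ℤ → ℕ) K →
    sumOver f (pairs K) ≡ sumOver (λ j → f +[1+ j ] + f -[1+ j ]) (downFrom K)
  sumOver-pairs f K =
    trans (sumOver-concatMap f pair (downFrom K))
          (sumOver-cong (downFrom K) (λ {j} _ → cong (f +[1+ j ] +_) (+-identityʳ (f -[1+ j ]))))

  zeroIf : ℕ → List ℤ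
  zeroIf zero    = []
  zeroIf (suc _) = +0 ∷ []

  C-split : ∀ q → C q ≡ zeroIf (q % 2) ++ concatMap pair (upTo (q / 2))
  C-split q with q % 2
  ... | zero  = refl
  ... | suc _ = refl

  C-even : ∀ K → C (2 * K) ≡ concatMap pair (upTo K)
  C-even K = trans (C-split (2 * K)) (cong₂ (λ r h → zeroIf r ++ concatMap pair (upTo h))
    (trans (cong (_% 2) (*-comm 2 K)) (m*n%n≡0 K 2))
    (trans (cong (_/ 2) (*-comm 2 K)) (m*n/n≡m K 2)))

  C-odd : ∀ K → C (suc (2 * K)) ≡ +0 ∷ concatMap pair (upTo K)
  C-odd K = trans (C-split (suc (2 * K))) (cong₂ (λ r h → zeroIf r ++ concatMap pair (upTo h))
    (trans (cong (λ k → suc k % 2) (*-comm 2 K)) ([m+kn]%n≡m%n 1 K 2))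
    (trans (cong (λ k → suc k / 2) (*-comm 2 K))
           (trans (+-distrib-/-∣ʳ 1 {K * 2} {2} (divides K refl)) (m*n/n≡m K 2))))

  sumOver-upTo-pairs : ∀ (f : ℤ → ℕ) K → sumOver f (concatMap pair (upTo K)) ≡ sumOver f (pairs K)
  sumOver-upTo-pairs f K = begin
    sumOver f (concatMap pair (upTo K))   ≡⟨ sumOver-concatMap f pair (upTo K) ⟩
    sumOver (sumOver f ∘′ pair) (upTo K)  ≡⟨ sumOver-↭ (sumOver f ∘′ pair) upTo↭downFrom ⟩
    sumOver (sumOver f ∘′ pair) (downFrom K) ≡⟨ sym (sumOver-concatMap f pair (downFrom K)) ⟩
    sumOver f (pairs K) ∎
    where
    upTo↭downFrom : upTo K ↭ downFrom K
    upTo↭downFrom = ↭-sym (subst (_↭ upTo K) (reverse-upTo K) (↭-reverse (upTo K)))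

  touches : List ℤ → ℕ → Bool
  touches F j = (+[1+ j ] ∈ᵇ F) ∨ (-[1+ j ] ∈ᵇ F)

  NoOpposites : List ℤ → Set
  NoOpposites F = ∀ j → ((+[1+ j ] ∈ᵇ F) ∧ (-[1+ j ] ∈ᵇ F)) ≡ false

  touched untouched : ℕ → List ℤ → ℕ
  touched   K F = sumOver (λ j → if touches F j then 1 else 0) (downFrom K)
  untouched K F = sumOver (λ j → if touches F j then 0 else 1) (downFrom K)

  touches-∷-self : ∀ σ j F → touches (σ · +[1+ j ] ∷ F) j ≡ true
  touches-∷-self pos j F rewrite ==-refl +[1+ j ] = refl
  touches-∷-self neg j F rewrite ==-refl -[1+ j ] = ∨-zeroʳ _

  touches-∷-other : ∀ σ {i j} F → i ≢ j → touches (σ · +[1+ j ] ∷ F) i ≡ touches F i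
  touches-∷-other pos {i} {j} F i≢j rewrite ==-≢ {+[1+ i ]} {+[1+ j ]} (λ { refl → i≢j refl }) = refl
  touches-∷-other neg {i} {j} F i≢j rewrite ==-≢ { -[1+ i ]} { -[1+ j ]} (λ { refl → i≢j refl }) = refl

  NoOpposites-∷ : ∀ σ j F → NoOpposites F → (- (σ · +[1+ j ]) ∈ᵇ F) ≡ false →
    NoOpposites (σ · +[1+ j ] ∷ F)
  NoOpposites-∷ σ j F apart opp i with i ≟ j
  NoOpposites-∷ pos j F apart opp i | yes refl rewrite ==-refl +[1+ j ] = opp
  NoOpposites-∷ neg j F apart opp i | yes refl rewrite ==-refl -[1+ j ] | opp = refl
  NoOpposites-∷ pos j F apart opp i | no i≢j
    rewrite ==-≢ {+[1+ i ]} {+[1+ j ]} (λ { refl → i≢j refl }) = apart i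
  NoOpposites-∷ neg j F apart opp i | no i≢j
    rewrite ==-≢ { -[1+ i ]} { -[1+ j ]} (λ { refl → i≢j refl }) = apart i

  touched-∷ : ∀ σ {K j} F → j < K → touches F j ≡ false →
    touched K (σ · +[1+ j ] ∷ F) ≡ suc (touched K F)
  touched-∷ σ {j = j} F j<K fresh = sumOver-downFrom-bump j<K
    (λ i≢j → cong (λ b → if b then 1 else 0) (sym (touches-∷-other σ F i≢j)))
    (cong (λ b → if b then 1 else 0) fresh)
    (cong (λ b → if b then 1 else 0) (touches-∷-self σ j F))

  untouched-∷ : ∀ σ {K j} F → j < K → touches F j ≡ false →
    untouched K F ≡ suc (untouched K (σ · +[1+ j ] ∷ F))
  untouched-∷ σ {j = j} F j<K fresh = sumOver-downFrom-bump j<K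
    (λ i≢j → cong (λ b → if b then 0 else 1) (touches-∷-other σ F i≢j))
    (cong (λ b → if b then 0 else 1) (touches-∷-self σ j F))
    (cong (λ b → if b then 0 else 1) fresh)

  free-pairs : ∀ K F → NoOpposites F → free (pairs K) F ≡ touched K F + 2 * untouched K F
  free-pairs K F apart = begin
    free (pairs K) F
      ≡⟨ sumOver-pairs _ K ⟩
    sumOver (λ j → (if +[1+ j ] ∈ᵇ F then 0 else 1) + (if -[1+ j ] ∈ᵇ F then 0 else 1)) (downFrom K)
      ≡⟨ sumOver-cong (downFrom K) (λ {j} _ → colours j) ⟩
    sumOver (λ j → (if touches F j then 1 else 0) + 2 * (if touches F j then 0 else 1)) (downFrom K)
      ≡⟨ sumOver-+ _ _ (downFrom K) ⟩
    touched K F + sumOver (λ j → 2 * (if touches F j then 0 else 1)) (downFrom K)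
      ≡⟨ cong (touched K F +_) (sumOver-*ˡ 2 _ (downFrom K)) ⟩
    touched K F + 2 * untouched K F ∎
    where
    colours : ∀ j → (if +[1+ j ] ∈ᵇ F then 0 else 1) + (if -[1+ j ] ∈ᵇ F then 0 else 1)
                  ≡ (if (+[1+ j ] ∈ᵇ F) ∨ (-[1+ j ] ∈ᵇ F) then 1 else 0)
                    + 2 * (if (+[1+ j ] ∈ᵇ F) ∨ (-[1+ j ] ∈ᵇ F) then 0 else 1)
    colours j with +[1+ j ] ∈ᵇ F | -[1+ j ] ∈ᵇ F | apart j
    ... | true  | false | _ = refl
    ... | false | true  | _ = refl
    ... | false | false | _ = refl

  -- Colourings of n vertices of kind neg followed by m of kind pos by colour pairs ±c, when u pairs
  -- have exactly one member used (by earlier vertices of kind neg) and v pairs are unused: the next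
  -- vertex of kind neg reuses a used colour of one of the u pairs, or opens one of the v pairs.
  joinCount : ℕ → ℕ → ℕ → ℕ → ℕ
  joinCount m u v zero    = (u + 2 * v) ↓ m
  joinCount m u v (suc n) = u * joinCount m u v n + 2 * v * joinCount m (suc u) (pred v) n

  negFirst : ℕ → ℕ → ℕ → List ℤ → ℕ
  negFirst K m n F = count (pairs K) F (map -_ F) (replicate n neg ++ replicate m pos)

  negFirst-pair : ∀ K m n F {j} → NoOpposites F → j < K →
    (∀ G → NoOpposites G → negFirst K m n G ≡ joinCount m (touched K G) (untouched K G) n) →
    (if +[1+ j ] ∈ᵇ map -_ F then 0 else negFirst K m n (+[1+ j ] ∷ F))
      + (if -[1+ j ] ∈ᵇ map -_ F then 0 else negFirst K m n (-[1+ j ] ∷ F))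
      ≡ (if (+[1+ j ] ∈ᵇ F) ∨ (-[1+ j ] ∈ᵇ F) then negFirst K m n F
         else 2 * joinCount m (suc (touched K F)) (pred (untouched K F)) n)
  negFirst-pair K m n F {j} apart j<K ih rewrite ∈ᵇ-map-neg +[1+ j ] F | ∈ᵇ-map-neg -[1+ j ] F
    with +[1+ j ] ∈ᵇ F in c∈F | -[1+ j ] ∈ᵇ F in -c∈F | apart j
  ... | true  | false | _ = trans (+-identityʳ _) (count-cong (replicate n neg ++ replicate m pos)
    (agree-dup F c∈F) (agree-dup (map -_ F) (trans (∈ᵇ-map-neg -[1+ j ] F) c∈F)))
  ... | false | true  | _ = count-cong (replicate n neg ++ replicate m pos)
    (agree-dup F -c∈F) (agree-dup (map -_ F) (trans (∈ᵇ-map-neg +[1+ j ] F) -c∈F))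
  ... | false | false | _ = cong₂ _+_ (unused pos -c∈F) (trans (unused neg c∈F) (sym (+-identityʳ _)))
    where
    fresh : touches F j ≡ false
    fresh = cong₂ _∨_ c∈F -c∈F
    unused : ∀ σ → (- (σ · +[1+ j ]) ∈ᵇ F) ≡ false →
      negFirst K m n (σ · +[1+ j ] ∷ F) ≡ joinCount m (suc (touched K F)) (pred (untouched K F)) n
    unused σ opp = trans (ih _ (NoOpposites-∷ σ j F apart opp))
      (cong₂ (λ a b → joinCount m a b n) (touched-∷ σ F j<K fresh)
                                          (cong pred (sym (untouched-∷ σ F j<K fresh))))

  negFirst≡joinCount : ∀ K m n F → NoOpposites F →
    negFirst K m n F ≡ joinCount m (touched K F) (untouched K F) n
  negFirst≡joinCount K m zero    F apart =
    trans (count-replicate-pos (pairs-unique K) m F (map -_ F)) (cong (_↓ m) (free-pairs K F apart))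
  negFirst≡joinCount K m (suc n) F apart = begin
    sumOver (λ x → if x ∈ᵇ map -_ F then 0 else negFirst K m n (x ∷ F)) (pairs K)
      ≡⟨ sumOver-pairs _ K ⟩
    sumOver (λ j → (if +[1+ j ] ∈ᵇ map -_ F then 0 else negFirst K m n (+[1+ j ] ∷ F))
                 + (if -[1+ j ] ∈ᵇ map -_ F then 0 else negFirst K m n (-[1+ j ] ∷ F))) (downFrom K)
      ≡⟨ sumOver-cong (downFrom K)
                      (λ j∈ → negFirst-pair K m n F apart (∈-downFrom⁻ j∈) (negFirst≡joinCount K m n)) ⟩
    sumOver (λ j → if touches F j then negFirst K m n F else 2 * J′) (downFrom K)
      ≡⟨ sumOver-if-split (touches F) (negFirst K m n F) (2 * J′) (downFrom K) ⟩
    u * negFirst K m n F + v * (2 * J′)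
      ≡⟨ cong₂ _+_ (cong (u *_) (negFirst≡joinCount K m n F apart))
                   (trans (sym (*-assoc v 2 J′)) (cong (_* J′) (*-comm v 2))) ⟩
    joinCount m u v (suc n) ∎
    where
    u v J′ : ℕ
    u  = touched K F
    v  = untouched K F
    J′ = joinCount m (suc u) (pred v) n

  touched-[] : ∀ K → touched K [] ≡ 0
  touched-[] K = sumOver-0 (downFrom K)

  untouched-[] : ∀ K → untouched K [] ≡ K
  untouched-[] zero    = refl
  untouched-[] (suc K) = cong suc (untouched-[] K)

  count-kinds : ∀ K m n → count (pairs K) [] [] (kinds m n) ≡ joinCount m 0 K n
  count-kinds K m n = begin
    count (pairs K) [] [] (replicate m pos ++ replicate n neg)
      ≡⟨ count-↭ (pairs K) (++-comm (replicate m pos) (replicate n neg)) ⟩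
    count (pairs K) [] [] (replicate n neg ++ replicate m pos)
      ≡⟨ negFirst≡joinCount K m n [] (λ _ → refl) ⟩
    joinCount m (touched K []) (untouched K []) n
      ≡⟨ cong₂ (λ u v → joinCount m u v n) (touched-[] K) (untouched-[] K) ⟩
    joinCount m 0 K n ∎

module ClosedForm where
  open import Defs using (sumTo; falling; falling₂; stirling; H₁ℕ)
  open import Data.Nat as ℕ using (ℕ; zero; suc; pred; _<_; s≤s)
  import Data.Nat.Properties as ℕₚ
  import Data.Nat.Tactic.RingSolver as ℕ-Solver
  open import Data.Integer using (ℤ; +_; _+_; _-_; _*_)
  open import Data.Integer.Properties
    using (pos-+; pos-*; +-identityʳ; *-identityˡ; *-identityʳ; *-zeroʳ; *-distribˡ-+; +-assoc;
           m-n≡m⊖n; [1+m]⊖[1+n]≡m⊖n)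
  open import Data.Integer.Tactic.RingSolver using (solve-∀)
  open import Relation.Binary.PropositionalEquality
    using (_≡_; refl; sym; trans; cong; cong₂; module ≡-Reasoning)
  open ≡-Reasoning
  open Counting using (_↓_)
  open PairColours using (joinCount)

  -- r-Stirling numbers: rStirling u n j counts the partitions of n elements into j nonempty blocks
  -- and u further labelled, possibly empty, blocks (so rStirling 0 = stirling); the recursion is on
  -- the first element, matching that of joinCount.
  rStirling : ℕ → ℕ → ℕ → ℕ
  rStirling u zero    zero    = 1
  rStirling u zero    (suc j) = 0
  rStirling u (suc n) zero    = u ℕ.* rStirling u n zero
  rStirling u (suc n) (suc j) = u ℕ.* rStirling u n (suc j) ℕ.+ rStirling (suc u) n j

  rStirling-vanishes : ∀ u n j → n < j → rStirling u n j ≡ 0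
  rStirling-vanishes u zero    (suc j) _         = refl
  rStirling-vanishes u (suc n) (suc j) (s≤s n<j)
    rewrite rStirling-vanishes u n (suc j) (ℕₚ.m<n⇒m<1+n n<j) | rStirling-vanishes (suc u) n j n<j
    = trans (ℕₚ.+-identityʳ (u ℕ.* 0)) (ℕₚ.*-zeroʳ u)

  rStirling-suc : ∀ u n j →
    rStirling u (suc n) (suc j) ≡ (u ℕ.+ suc j) ℕ.* rStirling u n (suc j) ℕ.+ rStirling u n j
  rStirling-suc u zero zero
    = cong (ℕ._+ 1) (trans (ℕₚ.*-zeroʳ u) (sym (ℕₚ.*-zeroʳ (u ℕ.+ 1))))
  rStirling-suc u zero (suc j)
    rewrite ℕₚ.*-zeroʳ u | ℕₚ.*-zeroʳ (u ℕ.+ suc (suc j)) = refl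
  rStirling-suc u (suc n) zero = begin
    u ℕ.* rStirling u (suc n) 1 ℕ.+ suc u ℕ.* rStirling (suc u) n zero
      ≡⟨ cong (λ r → u ℕ.* r ℕ.+ suc u ℕ.* rStirling (suc u) n zero) (rStirling-suc u n zero) ⟩
    u ℕ.* ((u ℕ.+ 1) ℕ.* rStirling u n 1 ℕ.+ rStirling u n 0) ℕ.+ suc u ℕ.* rStirling (suc u) n zero
      ≡⟨ rearrange u (rStirling u n 1) (rStirling u n 0) (rStirling (suc u) n 0) ⟩
    (u ℕ.+ 1) ℕ.* rStirling u (suc n) 1 ℕ.+ rStirling u (suc n) 0 ∎
    where
    rearrange : ∀ u a b c → u ℕ.* ((u ℕ.+ 1) ℕ.* a ℕ.+ b) ℕ.+ (1 ℕ.+ u) ℕ.* c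
                          ≡ (u ℕ.+ 1) ℕ.* (u ℕ.* a ℕ.+ c) ℕ.+ u ℕ.* b
    rearrange = ℕ-Solver.solve-∀
  rStirling-suc u (suc n) (suc j) = begin
    u ℕ.* rStirling u (suc n) (suc (suc j)) ℕ.+ rStirling (suc u) (suc n) (suc j)
      ≡⟨ cong₂ (λ r s → u ℕ.* r ℕ.+ s) (rStirling-suc u n (suc j)) (rStirling-suc (suc u) n j) ⟩
    u ℕ.* ((u ℕ.+ suc (suc j)) ℕ.* a ℕ.+ b) ℕ.+ ((suc u ℕ.+ suc j) ℕ.* c ℕ.+ d)
      ≡⟨ cong (λ k → u ℕ.* ((u ℕ.+ suc (suc j)) ℕ.* a ℕ.+ b) ℕ.+ (k ℕ.* c ℕ.+ d)) (sym (ℕₚ.+-suc u (suc j))) ⟩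
    u ℕ.* ((u ℕ.+ suc (suc j)) ℕ.* a ℕ.+ b) ℕ.+ ((u ℕ.+ suc (suc j)) ℕ.* c ℕ.+ d)
      ≡⟨ rearrange u (suc (suc j)) a b c d ⟩
    (u ℕ.+ suc (suc j)) ℕ.* rStirling u (suc n) (suc (suc j)) ℕ.+ rStirling u (suc n) (suc j) ∎
    where
    a b c d : ℕ
    a = rStirling u n (suc (suc j))
    b = rStirling u n (suc j)
    c = rStirling (suc u) n (suc j)
    d = rStirling (suc u) n j
    rearrange : ∀ u J a b c d → u ℕ.* ((u ℕ.+ J) ℕ.* a ℕ.+ b) ℕ.+ ((u ℕ.+ J) ℕ.* c ℕ.+ d)
                              ≡ (u ℕ.+ J) ℕ.* (u ℕ.* a ℕ.+ c) ℕ.+ (u ℕ.* b ℕ.+ d)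
    rearrange = ℕ-Solver.solve-∀

  rStirling-0 : ∀ n j → rStirling 0 n j ≡ stirling n j
  rStirling-0 zero    zero    = refl
  rStirling-0 zero    (suc j) = refl
  rStirling-0 (suc n) zero    = refl
  rStirling-0 (suc n) (suc j) = trans (rStirling-suc 0 n j)
    (cong₂ (λ a b → suc j ℕ.* a ℕ.+ b) (rStirling-0 n (suc j)) (rStirling-0 n j))

  sumTo-cong : ∀ n {f g : ℕ → ℤ} → (∀ j → f j ≡ g j) → sumTo n f ≡ sumTo n g
  sumTo-cong zero    f≗g = f≗g 0
  sumTo-cong (suc n) f≗g = cong₂ _+_ (sumTo-cong n f≗g) (f≗g (suc n))

  sumTo-shift : ∀ n (f : ℕ → ℤ) → sumTo (suc n) f ≡ f 0 + sumTo n (λ j → f (suc j))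
  sumTo-shift zero    f = refl
  sumTo-shift (suc n) f = trans (cong (_+ f (suc (suc n))) (sumTo-shift n f)) (+-assoc (f 0) _ _)

  sumTo-+ : ∀ n (f g : ℕ → ℤ) → sumTo n (λ j → f j + g j) ≡ sumTo n f + sumTo n g
  sumTo-+ zero    f g = refl
  sumTo-+ (suc n) f g = trans (cong (_+ (f (suc n) + g (suc n))) (sumTo-+ n f g))
                              (interchange (sumTo n f) (sumTo n g) (f (suc n)) (g (suc n)))
    where
    interchange : ∀ a b c d → a + b + (c + d) ≡ a + c + (b + d)
    interchange = solve-∀

  sumTo-*ˡ : ∀ n c (f : ℕ → ℤ) → sumTo n (λ j → c * f j) ≡ c * sumTo n f
  sumTo-*ˡ zero    c f = refl
  sumTo-*ˡ (suc n) c f =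
    trans (cong (_+ c * f (suc n)) (sumTo-*ˡ n c f)) (sym (*-distribˡ-+ c (sumTo n f) (f (suc n))))

  falling-suc : ∀ x m → falling x (suc m) ≡ x * falling (x - + 1) m
  falling-suc x zero    = trans (*-identityˡ (x - + 0)) (trans (+-identityʳ x) (sym (*-identityʳ x)))
  falling-suc x (suc m) =
    trans (cong (_* (x - + suc m)) (falling-suc x m)) (rearrange x (falling (x - + 1) m) (+ 1) (+ m))
    where
    rearrange : ∀ a b c d → a * b * (a - (c + d)) ≡ a * (b * (a - c - d))
    rearrange = solve-∀

  falling₂-suc : ∀ x j → falling₂ x (suc j) ≡ x * falling₂ (x - + 2) j
  falling₂-suc x zero    = trans (*-identityˡ (x - + 0)) (trans (+-identityʳ x) (sym (*-identityʳ x)))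
  falling₂-suc x (suc j) = begin
    falling₂ x (suc j) * (x - + (2 ℕ.* suc j))
      ≡⟨ cong₂ (λ a k → a * (x - + k)) (falling₂-suc x j) (ℕₚ.*-suc 2 j) ⟩
    x * falling₂ (x - + 2) j * (x - (+ 2 + + (2 ℕ.* j)))
      ≡⟨ rearrange x (falling₂ (x - + 2) j) (+ 2) (+ (2 ℕ.* j)) ⟩
    x * (falling₂ (x - + 2) j * (x - + 2 - + (2 ℕ.* j))) ∎
    where
    rearrange : ∀ a b c d → a * b * (a - (c + d)) ≡ a * (b * (a - c - d))
    rearrange = solve-∀

  ↓-falling : ∀ t m → + (t ↓ m) ≡ falling (+ t) m
  ↓-falling t       zero    = refl
  ↓-falling zero    (suc m) = sym (falling-suc (+ 0) m)
  ↓-falling (suc t) (suc m) = begin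
    + (suc t ℕ.* (t ↓ m))        ≡⟨ pos-* (suc t) (t ↓ m) ⟩
    + suc t * + (t ↓ m)          ≡⟨ cong (+ suc t *_) (↓-falling t m) ⟩
    + suc t * falling (+ t) m    ≡⟨ sym (falling-suc (+ suc t) m) ⟩
    falling (+ suc t) (suc m)    ∎

  -[1+]-cancel : ∀ a b → + suc a - + suc b ≡ + a - + b
  -[1+]-cancel a b = trans ([1+m]⊖[1+n]≡m⊖n a b) (sym (m-n≡m⊖n a b))

  summand : ℕ → ℕ → ℕ → ℕ → ℕ → ℤ
  summand m u v n j = + rStirling u n j * falling₂ (+ (2 ℕ.* v)) j * falling (+ (u ℕ.+ 2 ℕ.* v) - + j) m

  -- a new block takes a colour from one of the v unused pairs: 2v choices
  summand-fresh : ∀ m n u v j →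
    + rStirling (suc u) n j * falling₂ (+ (2 ℕ.* v)) (suc j) * falling (+ (u ℕ.+ 2 ℕ.* v) - + suc j) m
      ≡ + (2 ℕ.* v) * summand m (suc u) (pred v) n j
  summand-fresh m n u zero    j = begin
    + r * falling₂ (+ 0) (suc j) * h ≡⟨ cong (λ z → + r * z * h) (falling₂-suc (+ 0) j) ⟩
    + r * + 0 * h                   ≡⟨ cong (_* h) (*-zeroʳ (+ r)) ⟩
    + 0                             ∎
    where
    r : ℕ
    r = rStirling (suc u) n j
    h : ℤ
    h = falling (+ (u ℕ.+ 0) - + suc j) m
  summand-fresh m n u (suc v) j = begin
    + r * falling₂ (+ (2 ℕ.* suc v)) (suc j) * falling (+ (u ℕ.+ 2 ℕ.* suc v) - + suc j) m
      ≡⟨ cong₂ (λ a b → + r * a * falling b m)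
               (trans (falling₂-suc (+ (2 ℕ.* suc v)) j)
                      (cong (λ k → + (2 ℕ.* suc v) * falling₂ (+ k - + 2) j) (ℕₚ.*-suc 2 v)))
               (trans (cong (λ k → + k - + suc j) (shift u v)) (-[1+]-cancel (suc u ℕ.+ 2 ℕ.* v) j)) ⟩
    + r * (+ (2 ℕ.* suc v) * g) * h
      ≡⟨ rearrange (+ r) (+ (2 ℕ.* suc v)) g h ⟩
    + (2 ℕ.* suc v) * summand m (suc u) v n j ∎
    where
    r : ℕ
    r = rStirling (suc u) n j
    g h : ℤ
    g = falling₂ (+ (2 ℕ.* v)) j
    h = falling (+ (suc u ℕ.+ 2 ℕ.* v) - + j) m
    shift : ∀ u v → u ℕ.+ 2 ℕ.* suc v ≡ suc (suc u ℕ.+ 2 ℕ.* v)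
    shift u v = trans (cong (u ℕ.+_) (ℕₚ.*-suc 2 v)) (reassoc u (2 ℕ.* v))
      where
      reassoc : ∀ a b → a ℕ.+ (2 ℕ.+ b) ≡ 2 ℕ.+ (a ℕ.+ b)
      reassoc = ℕ-Solver.solve-∀
    rearrange : ∀ a b c d → a * (b * c) * d ≡ b * (a * c * d)
    rearrange = solve-∀

  sumTo-summand-top : ∀ m n u v → sumTo (suc n) (summand m u v n) ≡ sumTo n (summand m u v n)
  sumTo-summand-top m n u v =
    trans (cong (λ r → sumTo n (summand m u v n) + + r * ψ * φ) (rStirling-vanishes u n (suc n) (ℕₚ.n<1+n n)))
          (+-identityʳ _)
    where
    ψ φ : ℤ
    ψ = falling₂ (+ (2 ℕ.* v)) (suc n)
    φ = falling (+ (u ℕ.+ 2 ℕ.* v) - + suc n) m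

  summand-suc-zero : ∀ m n u v → summand m u v (suc n) 0 ≡ + u * summand m u v n 0
  summand-suc-zero m n u v = trans (cong (λ z → z * ψ * φ) (pos-* u (rStirling u n 0)))
                                   (rearrange (+ u) (+ rStirling u n 0) ψ φ)
    where
    ψ φ : ℤ
    ψ = falling₂ (+ (2 ℕ.* v)) 0
    φ = falling (+ (u ℕ.+ 2 ℕ.* v) - + 0) m
    rearrange : ∀ a b c d → a * b * c * d ≡ a * (b * c * d)
    rearrange = solve-∀

  summand-suc-suc : ∀ m n u v j → summand m u v (suc n) (suc j)
    ≡ + u * summand m u v n (suc j)
      + + rStirling (suc u) n j * falling₂ (+ (2 ℕ.* v)) (suc j) * falling (+ (u ℕ.+ 2 ℕ.* v) - + suc j) m
  summand-suc-suc m n u v j =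
    trans (cong (λ z → z * ψ * φ) (trans (pos-+ (u ℕ.* a) b) (cong (_+ + b) (pos-* u a))))
          (rearrange (+ u) (+ a) (+ b) ψ φ)
    where
    a b : ℕ
    a = rStirling u n (suc j)
    b = rStirling (suc u) n j
    ψ φ : ℤ
    ψ = falling₂ (+ (2 ℕ.* v)) (suc j)
    φ = falling (+ (u ℕ.+ 2 ℕ.* v) - + suc j) m
    rearrange : ∀ a b c d e → (a * b + c) * d * e ≡ a * (b * d * e) + c * d * e
    rearrange = solve-∀

  sumTo-summand-suc : ∀ m n u v →
    sumTo (suc n) (summand m u v (suc n))
      ≡ + u * sumTo n (summand m u v n) + + (2 ℕ.* v) * sumTo n (summand m (suc u) (pred v) n)
  sumTo-summand-suc m n u v = begin
    sumTo (suc n) T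
      ≡⟨ sumTo-shift n T ⟩
    T 0 + sumTo n (λ j → T (suc j))
      ≡⟨ cong₂ _+_ (summand-suc-zero m n u v)
                   (trans (sumTo-cong n (summand-suc-suc m n u v)) (sumTo-+ n (λ j → + u * S (suc j)) W)) ⟩
    + u * S 0 + (sumTo n (λ j → + u * S (suc j)) + sumTo n W)
      ≡⟨ cong (λ a → + u * S 0 + (a + sumTo n W)) (sumTo-*ˡ n (+ u) (λ j → S (suc j))) ⟩
    + u * S 0 + (+ u * sumTo n (λ j → S (suc j)) + sumTo n W)
      ≡⟨ sym (+-assoc (+ u * S 0) _ _) ⟩
    + u * S 0 + + u * sumTo n (λ j → S (suc j)) + sumTo n W
      ≡⟨ cong (_+ sumTo n W) (sym (*-distribˡ-+ (+ u) (S 0) _)) ⟩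
    + u * (S 0 + sumTo n (λ j → S (suc j))) + sumTo n W
      ≡⟨ cong (λ a → + u * a + sumTo n W) (trans (sym (sumTo-shift n S)) (sumTo-summand-top m n u v)) ⟩
    + u * sumTo n S + sumTo n W
      ≡⟨ cong (λ a → + u * sumTo n S + a)
              (trans (sumTo-cong n (summand-fresh m n u v)) (sumTo-*ˡ n (+ (2 ℕ.* v)) S′)) ⟩
    + u * sumTo n S + + (2 ℕ.* v) * sumTo n S′ ∎
    where
    S S′ T W : ℕ → ℤ
    S  = summand m u v n
    S′ = summand m (suc u) (pred v) n
    T  = summand m u v (suc n)
    W j = + rStirling (suc u) n j * falling₂ (+ (2 ℕ.* v)) (suc j) * falling (+ (u ℕ.+ 2 ℕ.* v) - + suc j) m

  joinCount-closed : ∀ m n u v → + joinCount m u v n ≡ sumTo n (summand m u v n)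
  joinCount-closed m zero    u v = begin
    + ((u ℕ.+ 2 ℕ.* v) ↓ m)                 ≡⟨ ↓-falling (u ℕ.+ 2 ℕ.* v) m ⟩
    falling (+ (u ℕ.+ 2 ℕ.* v)) m           ≡⟨ cong (λ x → falling x m) (sym (+-identityʳ _)) ⟩
    falling (+ (u ℕ.+ 2 ℕ.* v) - + 0) m     ≡⟨ sym (*-identityˡ _) ⟩
    summand m u v zero 0                    ∎
  joinCount-closed m (suc n) u v = begin
    + (u ℕ.* J ℕ.+ 2 ℕ.* v ℕ.* J′)
      ≡⟨ trans (pos-+ (u ℕ.* J) _) (cong₂ _+_ (pos-* u J) (pos-* (2 ℕ.* v) J′)) ⟩
    + u * + J + + (2 ℕ.* v) * + J′
      ≡⟨ cong₂ (λ a b → + u * a + + (2 ℕ.* v) * b)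
               (joinCount-closed m n u v) (joinCount-closed m n (suc u) (pred v)) ⟩
    + u * sumTo n (summand m u v n) + + (2 ℕ.* v) * sumTo n (summand m (suc u) (pred v) n)
      ≡⟨ sym (sumTo-summand-suc m n u v) ⟩
    sumTo (suc n) (summand m u v (suc n)) ∎
    where
    J J′ : ℕ
    J  = joinCount m u v n
    J′ = joinCount m (suc u) (pred v) n

  joinCount-H₁ : ∀ m n K → + joinCount m 0 K n ≡ H₁ℕ 0 m n (+ (2 ℕ.* K))
  joinCount-H₁ m n K = trans (joinCount-closed m n 0 K) (sumTo-cong n λ j →
    cong (λ s → + s * falling₂ (+ (2 ℕ.* K)) j * falling (+ (2 ℕ.* K) - + j) m)
         (trans (rStirling-0 n j) (sym (ℕₚ.*-identityˡ (stirling n j)))))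

open import Defs
open import Data.Nat using (ℕ; suc; _*_)
open import Data.Integer using (ℤ; +_; _+_; _-_) renaming (_*_ to _*ℤ_)
open import Data.Product using (_×_)
open import Relation.Binary.PropositionalEquality using (_≡_)
open import Data.Nat as ℕ using (pred)
open import Data.Nat.Properties using (+-assoc)
open import Data.Integer using (+0)
open import Data.Integer.Properties using (pos-+; pos-*)
open import Data.List using ([]; _∷_)
open import Data.Product using (_,_)
open import Relation.Binary.PropositionalEquality using (refl; sym; trans; cong; cong₂; module ≡-Reasoning)
open Sums using (sumOver)
open Counting using (count; kinds; count-colours; count-zero; deletions; sumOver-deletions-kinds)
open Properness using (chrom≡count)
open PairColours using (pairs; +0∉pairs; C-even; C-odd; sumOver-upTo-pairs; count-kinds)
open ClosedForm using (joinCount-H₁)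

E : ℕ → ℕ → ℕ → ℕ
E m n K = count (pairs K) [] [] (kinds m n)

chrom-even : ∀ m n K → chrom (+K m ∨₊ -K n) (2 * K) ≡ E m n K
chrom-even m n K = trans (chrom≡count m n (2 * K)) (count-colours same [] [] (kinds m n))
  where
  same : ∀ f → sumOver f (C (2 * K)) ≡ sumOver f (pairs K)
  same f = trans (cong (sumOver f) (C-even K)) (sumOver-upTo-pairs f K)

chrom-odd : ∀ m n K → chrom (+K m ∨₊ -K n) (suc (2 * K)) ≡ E m n K ℕ.+ m * E (pred m) n K ℕ.+ n * E m (pred n) K
chrom-odd m n K = begin
  chrom (+K m ∨₊ -K n) (suc (2 * K))
    ≡⟨ trans (chrom≡count m n (suc (2 * K))) (count-colours same [] [] (kinds m n)) ⟩
  count (+0 ∷ pairs K) [] [] (kinds m n)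
    ≡⟨ count-zero (+0∉pairs K) (kinds m n) refl refl ⟩
  E m n K ℕ.+ sumOver (count (pairs K) [] []) (deletions (kinds m n))
    ≡⟨ cong (E m n K ℕ.+_) (sumOver-deletions-kinds (count (pairs K) [] []) m n) ⟩
  E m n K ℕ.+ (m * E (pred m) n K ℕ.+ n * E m (pred n) K)
    ≡⟨ sym (+-assoc (E m n K) _ _) ⟩
  E m n K ℕ.+ m * E (pred m) n K ℕ.+ n * E m (pred n) K ∎
  where
  open ≡-Reasoning
  same : ∀ f → sumOver f (C (suc (2 * K))) ≡ sumOver f (+0 ∷ pairs K)
  same f = trans (cong (sumOver f) (C-odd K)) (cong (f +0 ℕ.+_) (sumOver-upTo-pairs f K))

E-H₁ : ∀ m n K → + E m n K ≡ H₁ (+ 0) (+ m) (+ n) (+ (2 * K))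
E-H₁ m n K = trans (cong +_ (count-kinds K m n)) (joinCount-H₁ m n K)

pos-+-* : ∀ a m b n c → + (a ℕ.+ m * b ℕ.+ n * c) ≡ + a + + m *ℤ + b + + n *ℤ + c
pos-+-* a m b n c = trans (pos-+ (a ℕ.+ m * b) (n * c))
  (cong₂ _+_ (trans (pos-+ a (m * b)) (cong (λ z → + a + z) (pos-* m b))) (pos-* n c))

-- For m = 0 the factor + m kills the term, whatever H₁ returns at the negative argument + 0 - + 1.
*-pred-cong : ∀ m {f : ℕ → ℤ} (g : ℤ → ℤ) → (∀ k → f k ≡ g (+ k)) → + m *ℤ f (pred m) ≡ + m *ℤ g (+ m - + 1)
*-pred-cong ℕ.zero  g f≗g = refl
*-pred-cong (suc m) g f≗g = cong (+ suc m *ℤ_) (f≗g m)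

corollary3p3 : (m n : ℕ) →
    ((k : ℕ) → + chrom (+K m ∨₊ -K n) (2 * k) ≡ H₁ (+ 0) (+ m) (+ n) (+ (2 * k)))
    × ((k : ℕ) → + chrom (+K m ∨₊ -K n) (suc (2 * k))
        ≡ + chrom (+K m ∨₊ -K n) (2 * k)
          + (+ m) *ℤ H₁ (+ 0) (+ m - + 1) (+ n) (+ suc (2 * k) - + 1)
          + (+ n) *ℤ H₁ (+ 0) (+ m) (+ n - + 1) (+ suc (2 * k) - + 1))
corollary3p3 m n = (λ k → trans (cong +_ (chrom-even m n k)) (E-H₁ m n k)) , λ k → begin
  + chrom (+K m ∨₊ -K n) (suc (2 * k))
    ≡⟨ cong +_ (chrom-odd m n k) ⟩
  + (E m n k ℕ.+ m * E (pred m) n k ℕ.+ n * E m (pred n) k)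
    ≡⟨ pos-+-* (E m n k) m (E (pred m) n k) n (E m (pred n) k) ⟩
  + E m n k + + m *ℤ + E (pred m) n k + + n *ℤ + E m (pred n) k
    ≡⟨ cong₂ _+_ (cong₂ _+_ (cong +_ (sym (chrom-even m n k)))
                            (*-pred-cong m (λ a → H₁ (+ 0) a (+ n) (+ (2 * k))) (λ m′ → E-H₁ m′ n k)))
                 (*-pred-cong n (λ b → H₁ (+ 0) (+ m) b (+ (2 * k))) (λ n′ → E-H₁ m n′ k)) ⟩
  + chrom (+K m ∨₊ -K n) (2 * k)
    + (+ m) *ℤ H₁ (+ 0) (+ m - + 1) (+ n) (+ suc (2 * k) - + 1)
    + (+ n) *ℤ H₁ (+ 0) (+ m) (+ n - + 1) (+ suc (2 * k) - + 1) ∎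
  where open ≡-Reasoning
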